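{- Let $\Sigma$ be a multiset type. For every first-order formula $\varphi$ over the vocabulary of $\Sigma$ with $k$ free variables, the function $[\![\varphi]\!]:V_k\Sigma\to\mathbf{Bool}$, which maps $(A,\bar a)$ to true iff $A\models\varphi(\bar a)$, is derivable, where $V_k\Sigma$ is regarded as a multiset type via the identifications $V_0\Sigma\equiv\Sigma$, $V_{k+1}\Sigma\equiv V_1(V_k\Sigma)$, $V_11\equiv1$, $V_1(\Sigma\times\Gamma)\equiv V_1\Sigma\times\Gamma+\Sigma\times V_1\Gamma$, $V_1(\Sigma+\Gamma)\equiv V_1\Sigma+V_1\Gamma$, $V_1\mathsf M\Sigma\equiv(1+V_1\Sigma)\times\mathsf M\Sigma$.
   Context: Multiset types are generated by $1$, $\Sigma+\Gamma$, $\Sigma\times\Gamma$, $\mathsf M\Sigma$ and viewed as classes of relational structures: $1$ is the one-element structure over the empty vocabulary; $\Sigma\times\Gamma$: disjoint union of $A\in\Sigma$ and $B\in\Gamma$ over vocabulary $voc(\Sigma)+voc(\Gamma)$ plus a unary relation marking elements of $A$; $\Sigma+\Gamma$: a structure of $\Sigma$ or of $\Gamma$ over $voc(\Sigma)+voc(\Gamma)$ plus a nullary relation true iff it comes from $\Sigma$; $\mathsf M\Sigma$: disjoint union of $A_1,\ldots,A_n\in\Sigma$ with nullary relations turned into unary ones (holding on elements of those $A_i$ where true), a binary equivalence $\sim$ whose classes are the universes of the $A_i$, plus one extra root element in no relation. $\mathbf{Bool}=1+1$. $V_k\Sigma$ is the set of pairs $(A,\bar a)$ with $A\in\Sigma$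 and $\bar a$ a $k$-tuple of (not necessarily distinct) elements of $A$; in $V_1\mathsf M\Sigma$ the summand $1$ corresponds to the root being distinguished. The derivable functions are the least class containing the prime functions $\mathit{union}:\mathsf M\mathsf M\Sigma\to\mathsf M\Sigma$; $\mathit{add}:\Sigma\times\mathsf M\Sigma\to\mathsf M\Sigma$; $\mathit{choices}:\mathsf M\Sigma\to\mathsf M(\Sigma\times\mathsf M\Sigma)$, $\{\!\{A_1,\ldots,A_n\}\!\}\mapsto\{\!\{(A_i,\{\!\{A_1,\ldots,A_n\}\!\}-\{\!\{A_i\}\!\}) : i=1..n\}\!\}$; $\mathit{de\text{ - }singleton}:\mathsf M\Sigma\to1+\Sigma$; $\mathit{empty}:1\to\mathsf M1$; identities; projections; coprojections; $\mathit{dist}:\Sigma\times(\Sigma_1+\Sigma_2)\to\Sigma\times\Sigma_1+\Sigma\times\Sigma_2$; and closed under pairing, co-pairing, mapping $\mathsf Mf$ and composition. -}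

module Defs where

open import Data.Nat using (ℕ; zero; suc)
open import Data.Fin using (Fin; zero; suc)
open import Data.List using (List; []; _∷_; length; lookup; concat; map)
open import Data.Vec using (Vec; []; _∷_; _∷ʳ_) renaming (map to vmap; lookup to vlookup)
open import Data.Product using (Σ; Σ-syntax; _×_; _,_; proj₁; proj₂)
open import Data.Sum using (_⊎_; inj₁; inj₂)
open import Data.Unit using (⊤; tt)
open import Data.Empty using (⊥)
open import Relation.Binary.PropositionalEquality using (_≡_)

infixr 6 _⊗_
infixr 5 _⊕_

data Ty : Set where
  one : Ty
  _⊕_ : Ty → Ty → Ty
  _⊗_ : Ty → Ty → Ty
  M   : Ty → Ty

-- Elements (structures) of a multiset type; finite multisets are
-- represented by lists (a multiset = list up to permutation).
Val : Ty → Set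
Val one     = ⊤
Val (S ⊕ T) = Val S ⊎ Val T
Val (S ⊗ T) = Val S × Val T
Val (M S)   = List (Val S)

-- Universe of the relational structure associated with a value.
El : (S : Ty) → Val S → Set
El one     _         = ⊤
El (S ⊕ T) (inj₁ a)  = El S a
El (S ⊕ T) (inj₂ b)  = El T b
El (S ⊗ T) (a , b)   = El S a ⊎ El T b
-- inj₁ tt is the extra root; inj₂ (i , u) is element u of the i-th member
El (M S)   xs        = ⊤ ⊎ Σ[ i ∈ Fin (length xs) ] El S (lookup xs i)

data Sym : Ty → ℕ → Set where
  ×l    : ∀ {S T n} → Sym S n → Sym (S ⊗ T) n
  ×r    : ∀ {S T n} → Sym T n → Sym (S ⊗ T) n
  ×mark : ∀ {S T} → Sym (S ⊗ T) 1
  +l    : ∀ {S T n} → Sym S n → Sym (S ⊕ T) n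
  +r    : ∀ {S T n} → Sym T n → Sym (S ⊕ T) n
  +mark : ∀ {S T} → Sym (S ⊕ T) 0
  Mpos  : ∀ {S n} → Sym S (suc n) → Sym (M S) (suc n)
  Mnull : ∀ {S} → Sym S 0 → Sym (M S) 1          -- nullary turned unary
  Msim  : ∀ {S} → Sym (M S) 2

Holds : ∀ {S n} → Sym S n → (a : Val S) → Vec (El S a) n → Set
Holds {S ⊗ T} {n} (×l s) (a , b) args =
  Σ[ us ∈ Vec (El S a) n ] ((args ≡ vmap inj₁ us) × Holds s a us)
Holds {S ⊗ T} {n} (×r s) (a , b) args =
  Σ[ us ∈ Vec (El T b) n ] ((args ≡ vmap inj₂ us) × Holds s b us)
Holds {S ⊗ T} ×mark (a , b) (e ∷ []) = Σ[ u ∈ El S a ] (e ≡ inj₁ u)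
Holds (+l s) (inj₁ a) args = Holds s a args
Holds (+l s) (inj₂ b) args = ⊥
Holds (+r s) (inj₁ a) args = ⊥
Holds (+r s) (inj₂ b) args = Holds s b args
Holds +mark (inj₁ a) [] = ⊤
Holds +mark (inj₂ b) [] = ⊥
Holds {M S} {n} (Mpos s) xs args =
  Σ[ i ∈ Fin (length xs) ] Σ[ us ∈ Vec (El S (lookup xs i)) n ]
    ((args ≡ vmap (λ u → inj₂ (i , u)) us) × Holds s (lookup xs i) us)
Holds {M S} (Mnull s) xs (e ∷ []) =
  Σ[ i ∈ Fin (length xs) ] Σ[ u ∈ El S (lookup xs i) ]
    ((e ≡ inj₂ (i , u)) × Holds s (lookup xs i) [])
Holds {M S} Msim xs (e₁ ∷ e₂ ∷ []) =
  Σ[ i ∈ Fin (length xs) ] Σ[ u₁ ∈ El S (lookup xs i) ] Σ[ u₂ ∈ El S (lookup xs i) ]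
    ((e₁ ≡ inj₂ (i , u₁)) × (e₂ ≡ inj₂ (i , u₂)))

-- First-order formulas (with equality) over the vocabulary of S,
-- free variables among Fin k (de Bruijn; quantifiers bind index zero).

data Fm (S : Ty) (k : ℕ) : Set where
  rel : ∀ {n} → Sym S n → Vec (Fin k) n → Fm S k
  eq  : Fin k → Fin k → Fm S k
  neg : Fm S k → Fm S k
  and : Fm S k → Fm S k → Fm S k
  or  : Fm S k → Fm S k → Fm S k
  all : Fm S (suc k) → Fm S k
  ex  : Fm S (suc k) → Fm S k

Sat : ∀ {S k} → Fm S k → (a : Val S) → Vec (El S a) k → Set
Sat (rel s vs) a ρ = Holds s a (vmap (vlookup ρ) vs)
Sat (eq i j)   a ρ = vlookup ρ i ≡ vlookup ρ j
Sat (neg φ)    a ρ = Sat φ a ρ → ⊥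
Sat (and φ ψ)  a ρ = Sat φ a ρ × Sat ψ a ρ
Sat (or φ ψ)   a ρ = Sat φ a ρ ⊎ Sat ψ a ρ
Sat {S} (all φ) a ρ = (e : El S a) → Sat φ a (e ∷ ρ)
Sat {S} (ex φ)  a ρ = Σ[ e ∈ El S a ] Sat φ a (e ∷ ρ)

Bool : Ty
Bool = one ⊕ one

true : Val Bool
true = inj₁ tt

data Der : Ty → Ty → Set where
  union       : ∀ {S} → Der (M (M S)) (M S)
  add         : ∀ {S} → Der (S ⊗ M S) (M S)
  choices     : ∀ {S} → Der (M S) (M (S ⊗ M S))
  de-singleton : ∀ {S} → Der (M S) (one ⊕ S)
  empty       : Der one (M one)
  idD         : ∀ {S} → Der S S
  π₁          : ∀ {S T} → Der (S ⊗ T) S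
  π₂          : ∀ {S T} → Der (S ⊗ T) T
  ι₁          : ∀ {S T} → Der S (S ⊕ T)
  ι₂          : ∀ {S T} → Der T (S ⊕ T)
  dist        : ∀ {S S₁ S₂} → Der (S ⊗ (S₁ ⊕ S₂)) ((S ⊗ S₁) ⊕ (S ⊗ S₂))
  pair        : ∀ {S T₁ T₂} → Der S T₁ → Der S T₂ → Der S (T₁ ⊗ T₂)
  copair      : ∀ {S₁ S₂ T} → Der S₁ T → Der S₂ T → Der (S₁ ⊕ S₂) T
  mapM        : ∀ {S T} → Der S T → Der (M S) (M T)
  comp        : ∀ {S T U} → Der T U → Der S T → Der S U

choicesL : ∀ {A : Set} → List A → List (A × List A)
choicesL []       = []
choicesL (x ∷ xs) = (x , xs) ∷ map (λ p → proj₁ p , x ∷ proj₂ p) (choicesL xs)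

desingL : ∀ {A : Set} → List A → ⊤ ⊎ A
desingL (x ∷ []) = inj₂ x
desingL _        = inj₁ tt

eval : ∀ {S T} → Der S T → Val S → Val T
eval union xss = concat xss
eval add (x , xs) = x ∷ xs
eval choices xs = choicesL xs
eval de-singleton xs = desingL xs
eval empty _ = []
eval idD x = x
eval π₁ (a , b) = a
eval π₂ (a , b) = b
eval ι₁ a = inj₁ a
eval ι₂ b = inj₂ b
eval dist (a , inj₁ b) = inj₁ (a , b)
eval dist (a , inj₂ c) = inj₂ (a , c)
eval (pair f g) x = eval f x , eval g x
eval (copair f g) (inj₁ x) = eval f x
eval (copair f g) (inj₂ y) = eval g y
eval (mapM f) xs = map (eval f) xs
eval (comp g f) x = eval g (eval f x)

V1 : Ty → Ty
V1 one     = one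
V1 (S ⊗ T) = (V1 S ⊗ T) ⊕ (S ⊗ V1 T)
V1 (S ⊕ T) = V1 S ⊕ V1 T
V1 (M S)   = (one ⊕ V1 S) ⊗ M S

dec1 : (S : Ty) → Val (V1 S) → Σ (Val S) (El S)
dec1 one tt = tt , tt
dec1 (S ⊗ T) (inj₁ (p , b)) = (proj₁ (dec1 S p) , b) , inj₁ (proj₂ (dec1 S p))
dec1 (S ⊗ T) (inj₂ (a , q)) = (a , proj₁ (dec1 T q)) , inj₂ (proj₂ (dec1 T q))
dec1 (S ⊕ T) (inj₁ p) = inj₁ (proj₁ (dec1 S p)) , proj₂ (dec1 S p)
dec1 (S ⊕ T) (inj₂ q) = inj₂ (proj₁ (dec1 T q)) , proj₂ (dec1 T q)
dec1 (M S) (inj₁ tt , m) = m , inj₁ tt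
dec1 (M S) (inj₂ p , m) = (proj₁ (dec1 S p) ∷ m) , inj₂ (zero , proj₂ (dec1 S p))

tr1 : (S : Ty) (p : Val (V1 S)) → El (V1 S) p → El S (proj₁ (dec1 S p))
tr1 one tt e = tt
tr1 (S ⊗ T) (inj₁ (p , b)) (inj₁ e) = inj₁ (tr1 S p e)
tr1 (S ⊗ T) (inj₁ (p , b)) (inj₂ e) = inj₂ e
tr1 (S ⊗ T) (inj₂ (a , q)) (inj₁ e) = inj₁ e
tr1 (S ⊗ T) (inj₂ (a , q)) (inj₂ e) = inj₂ (tr1 T q e)
tr1 (S ⊕ T) (inj₁ p) e = tr1 S p e
tr1 (S ⊕ T) (inj₂ q) e = tr1 T q e
tr1 (M S) (inj₁ tt , m) (inj₁ tt) = inj₁ tt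
tr1 (M S) (inj₁ tt , m) (inj₂ e) = e
tr1 (M S) (inj₂ p , m) (inj₁ e) = inj₂ (zero , tr1 S p e)
tr1 (M S) (inj₂ p , m) (inj₂ (inj₁ tt)) = inj₁ tt
tr1 (M S) (inj₂ p , m) (inj₂ (inj₂ (i , u))) = inj₂ (suc i , u)

V : ℕ → Ty → Ty
V zero    S = S
V (suc k) S = V1 (V k S)

mutual
  decK : (k : ℕ) (S : Ty) → Val (V k S) → Σ[ a ∈ Val S ] Vec (El S a) k
  decK zero S a = a , []
  decK (suc k) S x =
    proj₁ (decK k S (proj₁ (dec1 (V k S) x))) ,
    (proj₂ (decK k S (proj₁ (dec1 (V k S) x)))
       ∷ʳ trK k S (proj₁ (dec1 (V k S) x)) (proj₂ (dec1 (V k S) x)))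

  trK : (k : ℕ) (S : Ty) (y : Val (V k S)) → El (V k S) y → El S (proj₁ (decK k S y))
  trK zero S y e = e
  trK (suc k) S x e = trK k S (proj₁ (dec1 (V k S) x)) (tr1 (V k S) x e)

-- A formula with k free variables is compiled into a derivable test on
-- structures whose elements carry k flags, flag i marking the value of
-- variable i. Connectives are Boolean combinations, atoms search for flagged
-- elements, and a quantifier runs its body on every way of setting one new
-- flag at a single element. That enumeration is derivable from choices
-- (together with a derived strength X × M Y → M (X × Y)); it lists the
-- members of multisets in a different order, so its correctness holds up to
-- isomorphism, which derivable functions respect. Finally, a V_k-structure
-- becomes a flagged structure by turning its distinguished points into
-- flags, one V₁ layer at a time.

module Submission where

open import Defs
open import Data.Nat using (ℕ; zero; suc)
open import Data.Fin using (Fin; zero; suc; lift; inject₁; fromℕ)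
open import Data.List using (List; []; _∷_; _++_; map; concat; [_]; length; lookup)
open import Data.List.Properties using (map-∘; map-cong; concat-map; concat-map-[_]; ++-identityʳ)
open import Data.List.Relation.Unary.Any using (Any; here; there)
import Data.List.Relation.Unary.Any as Any
import Data.List.Relation.Unary.Any.Properties as Any
open import Data.List.Relation.Unary.All using (All; []; _∷_)
import Data.List.Relation.Unary.All as All
import Data.List.Relation.Unary.All.Properties as All
open import Data.Product using (Σ; Σ-syntax; _×_; _,_; proj₁; proj₂)
import Data.Product as Product
open import Data.Sum using (_⊎_; inj₁; inj₂) renaming ([_,_] to [_,_]′)
open import Data.Sum.Properties using (inj₁-injective; inj₂-injective)
open import Data.Sum.Function.Propositional using (_⊎-⇔_)
open import Data.Product.Function.NonDependent.Propositional using (_×-⇔_)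
open import Data.Unit using (⊤; tt)
open import Data.Vec using (Vec; []; _∷_; _∷ʳ_) renaming (map to vmap; lookup to vlookup)
open import Data.Vec.Relation.Binary.Pointwise.Inductive using (Pointwise; []; _∷_)
open import Data.Empty using (⊥; ⊥-elim)
open import Function using (_∘_; id)
open import Function.Bundles using (_⇔_; mk⇔; Equivalence)
open import Function.Properties.Equivalence using (⇔-isEquivalence)
open import Level using (0ℓ)
open import Relation.Binary.Structures using (IsEquivalence)
open import Relation.Nullary using (¬_; Dec; yes; no)
import Relation.Nullary.Decidable as Dec
open import Relation.Nullary.Decidable using (decidable-stable)
open import Function.Related.TypeIsomorphisms using (¬-cong-⇔)
open import Relation.Binary.PropositionalEquality
  using (_≡_; _≢_; refl; sym; trans; cong; cong₂; subst; subst₂; module ≡-Reasoning)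

open IsEquivalence (⇔-isEquivalence {ℓ = 0ℓ})
  using () renaming (refl to ⇔-refl; sym to ⇔-sym; trans to ⇔-trans)

false : Val Bool
false = inj₂ tt

terminal : (S : Ty) → Der S one
terminal one     = idD
terminal (S ⊕ T) = copair (terminal S) (terminal T)
terminal (S ⊗ T) = comp (terminal S) π₁
terminal (M S)   = comp (copair idD (terminal S)) de-singleton

default : (S : Ty) → Der one S
default one     = idD
default (S ⊕ T) = comp ι₁ (default S)
default (S ⊗ T) = pair (default S) (default T)
default (M S)   = comp (mapM (default S)) empty

emptyD : (X S : Ty) → Der X (M S)
emptyD X S = comp (mapM (default S)) (comp empty (terminal X))

singletonD : (X : Ty) → Der X (M X)
singletonD X = comp add (pair idD (emptyD X X))

trueD falseD : (X : Ty) → Der X Bool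
trueD  X = comp ι₁ (terminal X)
falseD X = comp ι₂ (terminal X)

infixr 7 _∧D_
infixr 6 _∨D_

¬D_ : ∀ {X} → Der X Bool → Der X Bool
¬D t = comp (copair ι₂ ι₁) t

_∧D_ _∨D_ : ∀ {X} → Der X Bool → Der X Bool → Der X Bool
t ∧D u = comp (copair π₁ (comp ι₂ π₂)) (comp dist (pair u t))
t ∨D u = comp (copair (comp ι₁ π₂) π₁) (comp dist (pair u t))

¬D-true : ∀ {X} (t : Der X Bool) x → (eval (¬D t) x ≡ true) ⇔ (¬ eval t x ≡ true)
¬D-true t x with eval t x
... | inj₁ tt = mk⇔ (λ ()) (λ ¬t → ⊥-elim (¬t refl))
... | inj₂ tt = mk⇔ (λ _ ()) (λ _ → refl)

∧D-true : ∀ {X} (t u : Der X Bool) x →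
  (eval (t ∧D u) x ≡ true) ⇔ (eval t x ≡ true × eval u x ≡ true)
∧D-true t u x with eval t x | eval u x
... | inj₁ tt | inj₁ tt = mk⇔ (λ _ → refl , refl) (λ _ → refl)
... | inj₁ tt | inj₂ tt = mk⇔ (λ ()) (λ ())
... | inj₂ tt | _       = mk⇔ (λ ()) (λ ())

∨D-true : ∀ {X} (t u : Der X Bool) x →
  (eval (t ∨D u) x ≡ true) ⇔ (eval t x ≡ true ⊎ eval u x ≡ true)
∨D-true t u x with eval t x | eval u x
... | inj₁ tt | _       = mk⇔ (λ _ → inj₁ refl) (λ _ → refl)
... | inj₂ tt | inj₁ tt = mk⇔ (λ _ → inj₂ refl) (λ _ → refl)
... | inj₂ tt | inj₂ tt = mk⇔ (λ ()) (λ { (inj₁ ()) ; (inj₂ ()) })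

-- Each truth value becomes {tt} or {}; with one extra tt, the union is a
-- singleton exactly when every truth value was false.
anyD : Der (M Bool) Bool
anyD = comp nonEmpty (comp union (mapM (copair (singletonD one) (emptyD one one))))
  where
  nonEmpty : Der (M one) Bool
  nonEmpty = comp de-singleton (comp add (pair (terminal (M one)) idD))

anyD-true : ∀ bs → (eval anyD bs ≡ true) ⇔ Any (_≡ true) bs
anyD-true [] = mk⇔ (λ ()) (λ ())
anyD-true (inj₁ tt ∷ bs) = mk⇔ (λ _ → here refl) (λ _ → refl)
anyD-true (inj₂ tt ∷ bs) = mk⇔
  (there ∘ Equivalence.to (anyD-true bs))
  (λ { (here ()) ; (there p) → Equivalence.from (anyD-true bs) p })

existsD : ∀ {S} → Der S Bool → Der (M S) Bool
existsD t = comp anyD (mapM t)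

existsD-true : ∀ {S} (t : Der S Bool) xs →
  (eval (existsD t) xs ≡ true) ⇔ Any (λ x → eval t x ≡ true) xs
existsD-true t xs = ⇔-trans (anyD-true (map (eval t) xs)) (mk⇔ Any.map⁻ Any.map⁺)

choicesL-map : ∀ {A B : Set} (f : A → B) xs →
  choicesL (map f xs) ≡ map (Product.map f (map f)) (choicesL xs)
choicesL-map f [] = refl
choicesL-map f (x ∷ xs) = cong ((f x , map f xs) ∷_) (begin
  map (λ p → proj₁ p , f x ∷ proj₂ p) (choicesL (map f xs))
    ≡⟨ cong (map _) (choicesL-map f xs) ⟩
  map (λ p → proj₁ p , f x ∷ proj₂ p) (map (Product.map f (map f)) (choicesL xs))
    ≡⟨ map-∘ (choicesL xs) ⟨
  map (λ p → f (proj₁ p) , f x ∷ map f (proj₂ p)) (choicesL xs)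
    ≡⟨ map-∘ (choicesL xs) ⟩
  map (Product.map f (map f)) (map (λ p → proj₁ p , x ∷ proj₂ p) (choicesL xs)) ∎)
  where open ≡-Reasoning

map-proj₁-choicesL : ∀ {A : Set} (xs : List A) → map proj₁ (choicesL xs) ≡ xs
map-proj₁-choicesL [] = refl
map-proj₁-choicesL (x ∷ xs) =
  cong (x ∷_) (trans (sym (map-∘ (choicesL xs))) (map-proj₁-choicesL xs))

-- Pairing with a context x : X is derivable by adding x as a tagged member
-- and reading it back off the complement of each choice.
module _ (X Y : Ty) where

  theLeft : Der (M (X ⊕ Y)) (one ⊕ X)
  theLeft = comp de-singleton (comp union (mapM (copair (singletonD X) (emptyD Y X))))

  pairWithLeft : Der (M (X ⊕ Y) ⊗ Y) (M (X ⊗ Y))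
  pairWithLeft = comp (copair (emptyD _ _) (comp (singletonD _) (pair π₂ π₁)))
                      (comp dist (pair π₂ (comp theLeft π₁)))

  pairChoice : Der ((X ⊕ Y) ⊗ M (X ⊕ Y)) (M (X ⊗ Y))
  pairChoice = comp (copair (emptyD _ _) pairWithLeft) (comp dist (pair π₂ π₁))

  strength : Der (X ⊗ M Y) (M (X ⊗ Y))
  strength = comp union (comp (mapM pairChoice)
    (comp choices (comp add (pair (comp ι₁ π₁) (comp (mapM ι₂) π₂)))))

  right-members-vanish : ∀ ys → concat (map (eval (copair (singletonD X) (emptyD Y X))) (map inj₂ ys)) ≡ []
  right-members-vanish [] = refl
  right-members-vanish (_ ∷ ys) = right-members-vanish ys

  pairChoice-right : ∀ x y ys → eval pairChoice (inj₂ y , inj₁ x ∷ map inj₂ ys) ≡ [ x , y ]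
  pairChoice-right x y ys rewrite right-members-vanish ys = refl

  eval-strength : ∀ x ys → eval strength (x , ys) ≡ map (x ,_) ys
  eval-strength x ys = begin
    concat (map (eval pairChoice) (map withX (choicesL (map inj₂ ys))))
      ≡⟨ cong (concat ∘ map (eval pairChoice) ∘ map withX) (choicesL-map inj₂ ys) ⟩
    concat (map (eval pairChoice) (map withX (map (Product.map inj₂ (map inj₂)) (choicesL ys))))
      ≡⟨ cong concat (trans (sym (map-∘ _)) (sym (map-∘ (choicesL ys)))) ⟩
    concat (map (λ p → eval pairChoice (inj₂ (proj₁ p) , inj₁ x ∷ map inj₂ (proj₂ p))) (choicesL ys))
      ≡⟨ cong concat (map-cong (λ p → pairChoice-right x (proj₁ p) (proj₂ p)) (choicesL ys)) ⟩
    concat (map (λ p → [ x , proj₁ p ]) (choicesL ys))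
      ≡⟨ cong concat (map-∘ (choicesL ys)) ⟩
    concat (map [_] (map (λ p → x , proj₁ p) (choicesL ys)))
      ≡⟨ concat-map-[ _ ] ⟩
    map (λ p → x , proj₁ p) (choicesL ys)
      ≡⟨ map-∘ (choicesL ys) ⟩
    map (x ,_) (map proj₁ (choicesL ys))
      ≡⟨ cong (map (x ,_)) (map-proj₁-choicesL ys) ⟩
    map (x ,_) ys ∎
    where
    open ≡-Reasoning
    withX : Val ((X ⊕ Y) ⊗ M (X ⊕ Y)) → Val ((X ⊕ Y) ⊗ M (X ⊕ Y))
    withX (c , rest) = c , inj₁ x ∷ rest

-- Isomorphism of structures: equality up to reordering the members of
-- multisets, at every depth.
infixr 5 _∷≅_
infixr 4 _,≅_

data Iso : (S : Ty) → Val S → Val S → Set where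
  one≅   : Iso one tt tt
  inj₁≅  : ∀ {S T a a'} → Iso S a a' → Iso (S ⊕ T) (inj₁ a) (inj₁ a')
  inj₂≅  : ∀ {S T b b'} → Iso T b b' → Iso (S ⊕ T) (inj₂ b) (inj₂ b')
  _,≅_   : ∀ {S T a a' b b'} → Iso S a a' → Iso T b b' → Iso (S ⊗ T) (a , b) (a' , b')
  []≅    : ∀ {S} → Iso (M S) [] []
  _∷≅_   : ∀ {S x x' xs xs'} → Iso S x x' → Iso (M S) xs xs' → Iso (M S) (x ∷ xs) (x' ∷ xs')
  swap≅  : ∀ {S} {x y : Val S} {xs} → Iso (M S) (x ∷ y ∷ xs) (y ∷ x ∷ xs)
  trans≅ : ∀ {S a b c} → Iso S a b → Iso S b c → Iso S a c

Iso-refl : (S : Ty) (a : Val S) → Iso S a a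
Iso-refl one     tt       = one≅
Iso-refl (S ⊕ T) (inj₁ a) = inj₁≅ (Iso-refl S a)
Iso-refl (S ⊕ T) (inj₂ b) = inj₂≅ (Iso-refl T b)
Iso-refl (S ⊗ T) (a , b)  = Iso-refl S a ,≅ Iso-refl T b
Iso-refl (M S)   []       = []≅
Iso-refl (M S)   (x ∷ xs) = Iso-refl S x ∷≅ Iso-refl (M S) xs

Iso-Bool⇒≡ : ∀ {b c} → Iso Bool b c → b ≡ c
Iso-Bool⇒≡ (inj₁≅ _)    = refl
Iso-Bool⇒≡ (inj₂≅ _)    = refl
Iso-Bool⇒≡ (trans≅ p q) = trans (Iso-Bool⇒≡ p) (Iso-Bool⇒≡ q)

Iso-length : ∀ {S xs ys} → Iso (M S) xs ys → length xs ≡ length ys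
Iso-length []≅          = refl
Iso-length (_ ∷≅ q)     = cong suc (Iso-length q)
Iso-length swap≅        = refl
Iso-length (trans≅ p q) = trans (Iso-length p) (Iso-length q)

map-Iso : ∀ {S T} (f : Val S → Val T) → (∀ {a b} → Iso S a b → Iso T (f a) (f b)) →
  ∀ {xs ys} → Iso (M S) xs ys → Iso (M T) (map f xs) (map f ys)
map-Iso f f-Iso []≅          = []≅
map-Iso f f-Iso (p ∷≅ q)     = f-Iso p ∷≅ map-Iso f f-Iso q
map-Iso f f-Iso swap≅        = swap≅
map-Iso f f-Iso (trans≅ p q) = trans≅ (map-Iso f f-Iso p) (map-Iso f f-Iso q)

map-Iso-pointwise : ∀ {S T} {f g : Val S → Val T} → (∀ a → Iso T (f a) (g a)) →
  ∀ xs → Iso (M T) (map f xs) (map g xs)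
map-Iso-pointwise f≅g []       = []≅
map-Iso-pointwise f≅g (x ∷ xs) = f≅g x ∷≅ map-Iso-pointwise f≅g xs

++-Isoˡ : ∀ {S xs ys} (zs : List (Val S)) → Iso (M S) xs ys → Iso (M S) (xs ++ zs) (ys ++ zs)
++-Isoˡ zs []≅          = Iso-refl _ zs
++-Isoˡ zs (p ∷≅ q)     = p ∷≅ ++-Isoˡ zs q
++-Isoˡ zs swap≅        = swap≅
++-Isoˡ zs (trans≅ p q) = trans≅ (++-Isoˡ zs p) (++-Isoˡ zs q)

++-Isoʳ : ∀ {S zs ws} (xs : List (Val S)) → Iso (M S) zs ws → Iso (M S) (xs ++ zs) (xs ++ ws)
++-Isoʳ []       r = r
++-Isoʳ (x ∷ xs) r = Iso-refl _ x ∷≅ ++-Isoʳ xs r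

++-comm-Iso : ∀ {S} (xs ys zs : List (Val S)) → Iso (M S) (xs ++ ys ++ zs) (ys ++ xs ++ zs)
++-comm-Iso {S} []       ys zs = Iso-refl (M S) (ys ++ zs)
++-comm-Iso {S} (x ∷ xs) ys zs =
  trans≅ (Iso-refl S x ∷≅ ++-comm-Iso xs ys zs) (move x ys (xs ++ zs))
  where
  move : ∀ x ys ws → Iso (M S) (x ∷ ys ++ ws) (ys ++ x ∷ ws)
  move x []       ws = Iso-refl (M S) (x ∷ ws)
  move x (y ∷ ys) ws = trans≅ swap≅ (Iso-refl S y ∷≅ move x ys ws)

concat-Iso : ∀ {S xss yss} → Iso (M (M S)) xss yss → Iso (M S) (concat xss) (concat yss)
concat-Iso []≅                          = []≅
concat-Iso {yss = ys ∷ _} (p ∷≅ q)      = trans≅ (++-Isoˡ _ p) (++-Isoʳ ys (concat-Iso q))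
concat-Iso {xss = xs ∷ ys ∷ zss} swap≅  = ++-comm-Iso xs ys (concat zss)
concat-Iso (trans≅ p q)                 = trans≅ (concat-Iso p) (concat-Iso q)

choicesL-Iso : ∀ {S xs ys} → Iso (M S) xs ys → Iso (M (S ⊗ M S)) (choicesL xs) (choicesL ys)
choicesL-Iso []≅ = []≅
choicesL-Iso {S} {x ∷ xs} {x' ∷ ys} (p ∷≅ q) =
  (p ,≅ q) ∷≅ trans≅ (map-Iso (restWith x) (restWith-Iso (Iso-refl S x)) (choicesL-Iso q))
                     (map-Iso-pointwise (λ c → restWith-Iso p (Iso-refl _ c)) (choicesL ys))
  where
  restWith : Val S → Val (S ⊗ M S) → Val (S ⊗ M S)
  restWith x (y , rest) = y , x ∷ rest
  restWith-Iso : ∀ {x x'} → Iso S x x' → ∀ {c c'} → Iso (S ⊗ M S) c c' →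
    Iso (S ⊗ M S) (restWith x c) (restWith x' c')
  restWith-Iso p (q ,≅ r) = q ,≅ (p ∷≅ r)
  restWith-Iso {x' = x'} p (trans≅ q r) =
    trans≅ (restWith-Iso p q) (restWith-Iso (Iso-refl S x') r)
choicesL-Iso {S} {x ∷ y ∷ xs} swap≅ =
  trans≅ swap≅ (Iso-refl _ _ ∷≅ Iso-refl _ _ ∷≅
    subst₂ (Iso (M (S ⊗ M S))) (map-∘ (choicesL xs)) (map-∘ (choicesL xs))
      (map-Iso-pointwise (λ c → Iso-refl S (proj₁ c) ,≅ swap≅) (choicesL xs)))
choicesL-Iso (trans≅ p q) = trans≅ (choicesL-Iso p) (choicesL-Iso q)

desingL-Iso : ∀ {S xs ys} → Iso (M S) xs ys → Iso (one ⊕ S) (desingL xs) (desingL ys)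
desingL-Iso []≅ = inj₁≅ one≅
desingL-Iso (_∷≅_ {xs = []}    {[]}    p q) = inj₂≅ p
desingL-Iso (_∷≅_ {xs = []}    {_ ∷ _} p q) with () ← Iso-length q
desingL-Iso (_∷≅_ {xs = _ ∷ _} {[]}    p q) with () ← Iso-length q
desingL-Iso (_∷≅_ {xs = _ ∷ _} {_ ∷ _} p q) = inj₁≅ one≅
desingL-Iso swap≅ = inj₁≅ one≅
desingL-Iso (trans≅ p q) = trans≅ (desingL-Iso p) (desingL-Iso q)

dist-Iso : ∀ {S S₁ S₂ a a' u u'} → Iso S a a' → Iso (S₁ ⊕ S₂) u u' →
  Iso ((S ⊗ S₁) ⊕ (S ⊗ S₂)) (eval dist (a , u)) (eval dist (a' , u'))
dist-Iso p (inj₁≅ q) = inj₁≅ (p ,≅ q)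
dist-Iso p (inj₂≅ q) = inj₂≅ (p ,≅ q)
dist-Iso {S} {a' = a'} p (trans≅ q r) = trans≅ (dist-Iso p q) (dist-Iso (Iso-refl S a') r)

eval-Iso : ∀ {S T} (t : Der S T) {a b} → Iso S a b → Iso T (eval t a) (eval t b)
eval-Iso union        p            = concat-Iso p
eval-Iso add          (p ,≅ q)     = p ∷≅ q
eval-Iso choices      p            = choicesL-Iso p
eval-Iso de-singleton p            = desingL-Iso p
eval-Iso empty        p            = []≅
eval-Iso idD          p            = p
eval-Iso π₁           (p ,≅ q)     = p
eval-Iso π₂           (p ,≅ q)     = q
eval-Iso ι₁           p            = inj₁≅ p
eval-Iso ι₂           p            = inj₂≅ p
eval-Iso dist         (p ,≅ q)     = dist-Iso p q
eval-Iso (pair f g)   p            = eval-Iso f p ,≅ eval-Iso g p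
eval-Iso (copair f g) (inj₁≅ p)    = eval-Iso f p
eval-Iso (copair f g) (inj₂≅ p)    = eval-Iso g p
eval-Iso (mapM f)     p            = map-Iso (eval f) (eval-Iso f) p
eval-Iso (comp g f)   p            = eval-Iso g (eval-Iso f p)
eval-Iso t            (trans≅ p q) = trans≅ (eval-Iso t p) (eval-Iso t q)

Flags : ℕ → Ty
Flags zero    = one
Flags (suc n) = Bool ⊗ Flags n

flag : ∀ {n} → Val (Flags n) → Fin n → Val Bool
flag (b , _) zero    = b
flag (_ , f) (suc i) = flag f i

flagD : ∀ {n} → Fin n → Der (Flags n) Bool
flagD zero    = π₁
flagD (suc i) = comp (flagD i) π₂

eval-flagD : ∀ {n} (i : Fin n) f → eval (flagD i) f ≡ flag f i
eval-flagD zero    (b , f) = refl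
eval-flagD (suc i) (b , f) = eval-flagD i f

-- S expanded by n unary relations, stored as a vector of n flags at every
-- element (for a multiset, the flags of its root sit next to the members).
Marked : ℕ → Ty → Ty
Marked n one     = Flags n
Marked n (S ⊕ T) = Marked n S ⊕ Marked n T
Marked n (S ⊗ T) = Marked n S ⊗ Marked n T
Marked n (M S)   = Flags n ⊗ M (Marked n S)

Preds : ℕ → Set → Set₁
Preds n A = Fin n → A → Set

infixr 9 _∘ᵖ_
_∘ᵖ_ : ∀ {n} {A B : Set} → Preds n B → (A → B) → Preds n A
(P ∘ᵖ f) i a = P i (f a)

infix 4 _≐_
_≐_ : ∀ {n} {A : Set} → Preds n A → Preds n A → Set
P ≐ Q = ∀ i a → P i a ⇔ Q i a

≐-refl : ∀ {n} {A : Set} {P : Preds n A} → P ≐ P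
≐-refl i a = ⇔-refl

Records : ∀ {n} {A : Set} → Val (Flags n) → Preds n A → A → Set
Records f P a = ∀ i → (flag f i ≡ true) ⇔ P i a

Records-cong : ∀ {n} {A : Set} f {P Q : Preds n A} a → P ≐ Q → Records f P a → Records f Q a
Records-cong f a P≐Q r i = ⇔-trans (r i) (P≐Q i a)

MemberEl : (S : Ty) → List (Val S) → Set
MemberEl S xs = Σ[ k ∈ Fin (length xs) ] El S (lookup xs k)

memberHere : ∀ S x xs → El S x → MemberEl S (x ∷ xs)
memberHere S x xs u = zero , u

memberThere : ∀ S x xs → MemberEl S xs → MemberEl S (x ∷ xs)
memberThere S x xs (k , u) = suc k , u

-- m is a with flag i set exactly at the elements satisfying P i.
mutual
  Marking : (n : ℕ) (S : Ty) → Val (Marked n S) → (a : Val S) → Preds n (El S a) → Set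
  Marking n one     f        tt       P = Records f P tt
  Marking n (S ⊕ T) (inj₁ m) (inj₁ a) P = Marking n S m a P
  Marking n (S ⊕ T) (inj₂ m) (inj₂ b) P = Marking n T m b P
  Marking n (S ⊕ T) (inj₁ m) (inj₂ b) P = ⊥
  Marking n (S ⊕ T) (inj₂ m) (inj₁ a) P = ⊥
  Marking n (S ⊗ T) (ma , mb) (a , b) P = Marking n S ma a (P ∘ᵖ inj₁) × Marking n T mb b (P ∘ᵖ inj₂)
  Marking n (M S)   (f , ms)  xs      P = Records f P (inj₁ tt) × Markings n S ms xs (P ∘ᵖ inj₂)

  Markings : (n : ℕ) (S : Ty) → List (Val (Marked n S)) → (xs : List (Val S)) →
    Preds n (MemberEl S xs) → Set
  Markings n S []       []       Q = ⊤
  Markings n S (m ∷ ms) (x ∷ xs) Q = Marking n S m x (Q ∘ᵖ memberHere S x xs) ×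
    Markings n S ms xs (Q ∘ᵖ memberThere S x xs)
  Markings n S []       (_ ∷ _)  Q = ⊥
  Markings n S (_ ∷ _)  []       Q = ⊥

mutual
  Marking-cong : ∀ n S m a {P Q} → P ≐ Q → Marking n S m a P → Marking n S m a Q
  Marking-cong n one     f        tt       P≐Q r = Records-cong f tt P≐Q r
  Marking-cong n (S ⊕ T) (inj₁ m) (inj₁ a) P≐Q r = Marking-cong n S m a P≐Q r
  Marking-cong n (S ⊕ T) (inj₂ m) (inj₂ b) P≐Q r = Marking-cong n T m b P≐Q r
  Marking-cong n (S ⊗ T) (ma , mb) (a , b) P≐Q (ra , rb) =
    Marking-cong n S ma a (λ i → P≐Q i ∘ inj₁) ra , Marking-cong n T mb b (λ i → P≐Q i ∘ inj₂) rb
  Marking-cong n (M S)   (f , ms)  xs      P≐Q (rf , rms) =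
    Records-cong f (inj₁ tt) P≐Q rf , Markings-cong n S ms xs (λ i → P≐Q i ∘ inj₂) rms

  Markings-cong : ∀ n S ms xs {P Q} → P ≐ Q → Markings n S ms xs P → Markings n S ms xs Q
  Markings-cong n S []       []       P≐Q r = tt
  Markings-cong n S (m ∷ ms) (x ∷ xs) P≐Q (rm , rms) =
    Marking-cong n S m x (λ i → P≐Q i ∘ memberHere S x xs) rm ,
    Markings-cong n S ms xs (λ i → P≐Q i ∘ memberThere S x xs) rms

Computes : ∀ {n S} → Der (Marked n S) Bool → ((a : Val S) → Preds n (El S a) → Set) → Set₁
Computes {n} {S} t H = ∀ m a P → Marking n S m a P → (eval t m ≡ true) ⇔ H a P

existsD-Markings : ∀ {n S} (t : Der (Marked n S) Bool) H → Computes t H →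
  ∀ ms xs Q → Markings n S ms xs Q →
  (eval (existsD t) ms ≡ true) ⇔ (Σ[ k ∈ Fin (length xs) ] H (lookup xs k) (Q ∘ᵖ (k ,_)))
existsD-Markings t H t-H ms xs Q r = ⇔-trans (existsD-true t ms) (members ms xs Q r)
  where
  members : ∀ ms xs Q → Markings _ _ ms xs Q →
    Any (λ m → eval t m ≡ true) ms ⇔ (Σ[ k ∈ Fin (length xs) ] H (lookup xs k) (Q ∘ᵖ (k ,_)))
  members [] [] Q r = mk⇔ (λ ()) (λ ())
  members (m ∷ ms) (x ∷ xs) Q (rm , rms) = mk⇔
    (λ { (here p)  → zero , Equivalence.to (t-H m x _ rm) p
       ; (there p) → Product.map suc id (Equivalence.to (members ms xs _ rms) p) })
    (λ { (zero  , h) → here (Equivalence.from (t-H m x _ rm) h)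
       ; (suc k , h) → there (Equivalence.from (members ms xs _ rms) (k , h)) })

flagD-true : ∀ {n} {A : Set} f (i : Fin n) (P : Preds n A) a → Records f P a →
  (eval (flagD i) f ≡ true) ⇔ P i a
flagD-true f i P a r rewrite eval-flagD i f = r i

Σ-⊎-⇔ : ∀ {A B : Set} {Q : A ⊎ B → Set} → Σ (A ⊎ B) Q ⇔ (Σ A (Q ∘ inj₁) ⊎ Σ B (Q ∘ inj₂))
Σ-⊎-⇔ = mk⇔ (λ { (inj₁ a , q) → inj₁ (a , q) ; (inj₂ b , q) → inj₂ (b , q) })
            [ Product.map inj₁ id , Product.map inj₂ id ]′

Σ-El-M-⇔ : ∀ {S xs} {Q : El (M S) xs → Set} →
  Σ (El (M S) xs) Q ⇔
  (Q (inj₁ tt) ⊎ Σ[ k ∈ Fin (length xs) ] Σ[ u ∈ El S (lookup xs k) ] Q (inj₂ (k , u)))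
Σ-El-M-⇔ = mk⇔ (λ { (inj₁ tt , q) → inj₁ q ; (inj₂ (k , u) , q) → inj₂ (k , u , q) })
               [ (inj₁ tt ,_) , (λ { (k , u , q) → inj₂ (k , u) , q }) ]′

FlaggedBoth : ∀ {n} S → Fin n → Fin n → (a : Val S) → Preds n (El S a) → Set
FlaggedBoth S i j a P = Σ[ e ∈ El S a ] (P i e × P j e)

flaggedBoth : ∀ {n} S → Fin n → Fin n → Der (Marked n S) Bool
flaggedBoth one     i j = flagD i ∧D flagD j
flaggedBoth (S ⊕ T) i j = copair (flaggedBoth S i j) (flaggedBoth T i j)
flaggedBoth (S ⊗ T) i j = comp (flaggedBoth S i j) π₁ ∨D comp (flaggedBoth T i j) π₂
flaggedBoth (M S)   i j = comp (flagD i ∧D flagD j) π₁ ∨D comp (existsD (flaggedBoth S i j)) π₂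

flagD∧flagD-true : ∀ {n} {A : Set} f (i j : Fin n) (P : Preds n A) a → Records f P a →
  (eval (flagD i ∧D flagD j) f ≡ true) ⇔ (P i a × P j a)
flagD∧flagD-true f i j P a r =
  ⇔-trans (∧D-true (flagD i) (flagD j) f) (flagD-true f i P a r ×-⇔ flagD-true f j P a r)

flaggedBoth-computes : ∀ {n} S (i j : Fin n) → Computes (flaggedBoth S i j) (FlaggedBoth S i j)
flaggedBoth-computes one i j f tt P r =
  ⇔-trans (flagD∧flagD-true f i j P tt r) (mk⇔ (tt ,_) proj₂)
flaggedBoth-computes (S ⊕ T) i j (inj₁ m) (inj₁ a) P r = flaggedBoth-computes S i j m a P r
flaggedBoth-computes (S ⊕ T) i j (inj₂ m) (inj₂ b) P r = flaggedBoth-computes T i j m b P r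
flaggedBoth-computes (S ⊗ T) i j (ma , mb) (a , b) P (ra , rb) =
  ⇔-trans (∨D-true (comp (flaggedBoth S i j) π₁) (comp (flaggedBoth T i j) π₂) (ma , mb))
    (⇔-trans (flaggedBoth-computes S i j ma a _ ra ⊎-⇔ flaggedBoth-computes T i j mb b _ rb)
      (⇔-sym Σ-⊎-⇔))
flaggedBoth-computes (M S) i j (f , ms) xs P (rf , rms) =
  ⇔-trans (∨D-true (comp (flagD i ∧D flagD j) π₁) (comp (existsD (flaggedBoth S i j)) π₂) (f , ms))
    (⇔-trans (flagD∧flagD-true f i j P (inj₁ tt) rf ⊎-⇔
              existsD-Markings (flaggedBoth S i j) (FlaggedBoth S i j) (flaggedBoth-computes S i j)
                ms xs _ rms)
      (⇔-sym (Σ-El-M-⇔ {S} {xs})))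

flagged : ∀ {n} S → Fin n → Der (Marked n S) Bool
flagged S i = flaggedBoth S i i

Flagged : ∀ {n} S → Fin n → (a : Val S) → Preds n (El S a) → Set
Flagged S i a P = Σ[ e ∈ El S a ] P i e

flagged-computes : ∀ {n} S (i : Fin n) → Computes (flagged S i) (Flagged S i)
flagged-computes S i m a P r =
  ⇔-trans (flaggedBoth-computes S i i m a P r) (mk⇔ (Product.map id proj₁) (Product.map id λ p → p , p))

∧D-computes : ∀ {n S} (t u : Der (Marked n S) Bool) (H K : (a : Val S) → Preds n (El S a) → Set) →
  Computes t H → Computes u K →
  Computes (t ∧D u) (λ a P → H a P × K a P)
∧D-computes t u H K t-H u-K m a P r = ⇔-trans (∧D-true t u m) (t-H m a P r ×-⇔ u-K m a P r)

HoldsOnFlagged : ∀ {n S m} → Sym S m → Vec (Fin n) m → (a : Val S) → Preds n (El S a) → Set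
HoldsOnFlagged {S = S} {m} s vs a P = Σ[ us ∈ Vec (El S a) m ] (Pointwise P vs us × Holds s a us)

Pointwise-map : ∀ {n m} {A B : Set} (P : Preds n B) (f : A → B) (vs : Vec (Fin n) m) (us : Vec A m) →
  Pointwise P vs (vmap f us) ⇔ Pointwise (P ∘ᵖ f) vs us
Pointwise-map P f [] [] = mk⇔ (λ _ → []) (λ _ → [])
Pointwise-map P f (v ∷ vs) (u ∷ us) = mk⇔
  (λ { (p ∷ ps) → p ∷ Equivalence.to (Pointwise-map P f vs us) ps })
  (λ { (p ∷ ps) → p ∷ Equivalence.from (Pointwise-map P f vs us) ps })

HoldsOnFlagged-image : ∀ {n m} {A B : Set} (P : Preds n B) (f : A → B) (vs : Vec (Fin n) m)
  (H : Vec A m → Set) →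
  (Σ[ us ∈ Vec A m ] (Pointwise (P ∘ᵖ f) vs us × H us)) ⇔
  (Σ[ ws ∈ Vec B m ] (Pointwise P vs ws × Σ[ us ∈ Vec A m ] ((ws ≡ vmap f us) × H us)))
HoldsOnFlagged-image P f vs H = mk⇔
  (λ { (us , fl , h) → vmap f us , Equivalence.from (Pointwise-map P f vs us) fl , us , refl , h })
  (λ { (_ , fl , us , refl , h) → us , Equivalence.to (Pointwise-map P f vs us) fl , h })

holdsD : ∀ {n S m} → Sym S m → Vec (Fin n) m → Der (Marked n S) Bool
holdsD {S = S ⊗ T} (×l s)    vs           = comp (holdsD s vs) π₁
holdsD {S = S ⊗ T} (×r s)    vs           = comp (holdsD s vs) π₂
holdsD {S = S ⊗ T} ×mark     (v ∷ [])     = comp (flagged S v) π₁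
holdsD {S = S ⊕ T} (+l s)    vs           = copair (holdsD s vs) (falseD _)
holdsD {S = S ⊕ T} (+r s)    vs           = copair (falseD _) (holdsD s vs)
holdsD {S = S ⊕ T} +mark     []           = copair (trueD _) (falseD _)
holdsD {S = M S}   (Mpos s)  vs           = comp (existsD (holdsD s vs)) π₂
holdsD {S = M S}   (Mnull s) (v ∷ [])     = comp (existsD (flagged S v ∧D holdsD s [])) π₂
holdsD {S = M S}   Msim      (v ∷ w ∷ []) = comp (existsD (flagged S v ∧D flagged S w)) π₂

holdsD-computes : ∀ {n S m} (s : Sym S m) (vs : Vec (Fin n) m) → Computes (holdsD s vs) (HoldsOnFlagged s vs)
holdsD-computes {S = S ⊗ T} (×l s) vs (ma , mb) (a , b) P (ra , rb) =
  ⇔-trans (holdsD-computes s vs ma a _ ra) (HoldsOnFlagged-image P inj₁ vs (Holds s a))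
holdsD-computes {S = S ⊗ T} (×r s) vs (ma , mb) (a , b) P (ra , rb) =
  ⇔-trans (holdsD-computes s vs mb b _ rb) (HoldsOnFlagged-image P inj₂ vs (Holds s b))
holdsD-computes {S = S ⊗ T} ×mark (v ∷ []) (ma , mb) (a , b) P (ra , rb) =
  ⇔-trans (flagged-computes S v ma a _ ra) (mk⇔
    (λ { (u , p) → inj₁ u ∷ [] , p ∷ [] , u , refl })
    (λ { (_ ∷ [] , p ∷ [] , u , refl) → u , p }))
holdsD-computes {S = S ⊕ T} (+l s) vs (inj₁ m) (inj₁ a) P r = holdsD-computes s vs m a P r
holdsD-computes {S = S ⊕ T} (+l s) vs (inj₂ m) (inj₂ b) P r = mk⇔ (λ ()) (λ ())
holdsD-computes {S = S ⊕ T} (+r s) vs (inj₁ m) (inj₁ a) P r = mk⇔ (λ ()) (λ ())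
holdsD-computes {S = S ⊕ T} (+r s) vs (inj₂ m) (inj₂ b) P r = holdsD-computes s vs m b P r
holdsD-computes {S = S ⊕ T} +mark [] (inj₁ m) (inj₁ a) P r = mk⇔ (λ _ → [] , [] , tt) (λ _ → refl)
holdsD-computes {S = S ⊕ T} +mark [] (inj₂ m) (inj₂ b) P r = mk⇔ (λ ()) (λ { ([] , [] , ()) })
holdsD-computes {S = M S} (Mpos s) vs (f , ms) xs P (rf , rms) =
  ⇔-trans (existsD-Markings (holdsD s vs) (HoldsOnFlagged s vs) (holdsD-computes s vs) ms xs _ rms)
    (mk⇔ (λ { (k , h) → let ws , fl , us , ws≡ , h′ = Equivalence.to (image k) h in ws , fl , k , us , ws≡ , h′ })
         (λ { (ws , fl , k , us , ws≡ , h) → k , Equivalence.from (image k) (ws , fl , us , ws≡ , h) }))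
  where
  image = λ k → HoldsOnFlagged-image P (λ u → inj₂ (k , u)) vs (Holds s (lookup xs k))
holdsD-computes {S = M S} (Mnull s) (v ∷ []) (f , ms) xs P (rf , rms) =
  ⇔-trans (existsD-Markings (flagged S v ∧D holdsD s []) _
            (∧D-computes {S = S} (flagged S v) (holdsD s []) (Flagged S v) (HoldsOnFlagged s [])
              (flagged-computes S v) (holdsD-computes s []))
            ms xs _ rms)
    (mk⇔ (λ { (k , (u , p) , [] , [] , h) → inj₂ (k , u) ∷ [] , p ∷ [] , k , u , refl , h })
         (λ { (_ ∷ [] , p ∷ [] , k , u , refl , h) → k , (u , p) , [] , [] , h }))
holdsD-computes {S = M S} Msim (v ∷ w ∷ []) (f , ms) xs P (rf , rms) =
  ⇔-trans (existsD-Markings (flagged S v ∧D flagged S w) _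
            (∧D-computes {S = S} (flagged S v) (flagged S w) (Flagged S v) (Flagged S w)
              (flagged-computes S v) (flagged-computes S w))
            ms xs _ rms)
    (mk⇔ (λ { (k , (u₁ , p₁) , (u₂ , p₂)) →
                inj₂ (k , u₁) ∷ inj₂ (k , u₂) ∷ [] , p₁ ∷ p₂ ∷ [] , k , u₁ , u₂ , refl , refl })
         (λ { (_ ∷ _ ∷ [] , p₁ ∷ p₂ ∷ [] , k , u₁ , u₂ , refl , refl) → k , (u₁ , p₁) , (u₂ , p₂) }))

infixr 5 _◂_
_◂_ : ∀ {n} {A : Set} → (A → Set) → Preds n A → Preds (suc n) A
(Q₀ ◂ P) zero    = Q₀
(Q₀ ◂ P) (suc i) = P i

◂-∘ᵖ : ∀ {n} {A B : Set} {Q : Preds (suc n) B} {Q₀ P} (f : A → B) →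
  Q ≐ Q₀ ◂ P → Q ∘ᵖ f ≐ (Q₀ ∘ f) ◂ (P ∘ᵖ f)
◂-∘ᵖ f Q≐ zero    a = Q≐ zero (f a)
◂-∘ᵖ f Q≐ (suc i) a = Q≐ (suc i) (f a)

Records-◂ : ∀ {n} {A : Set} b f {Q : Preds (suc n) A} {Q₀ P} a → Q ≐ Q₀ ◂ P →
  (b ≡ true) ⇔ Q₀ a → Records f P a → Records {suc n} (b , f) Q a
Records-◂ b f a Q≐ b⇔ r zero    = ⇔-trans b⇔ (⇔-sym (Q≐ zero a))
Records-◂ b f a Q≐ b⇔ r (suc i) = ⇔-trans (r i) (⇔-sym (Q≐ (suc i) a))

∅ : {A : Set} → A → Set
∅ _ = ⊥

consTrue consFalse : ∀ n → Der (Flags n) (Flags (suc n))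
consTrue  n = pair (trueD _) idD
consFalse n = pair (falseD _) idD

addFalseFlag : ∀ n S → Der (Marked n S) (Marked (suc n) S)
addFalseFlag n one     = consFalse n
addFalseFlag n (S ⊕ T) = copair (comp ι₁ (addFalseFlag n S)) (comp ι₂ (addFalseFlag n T))
addFalseFlag n (S ⊗ T) = pair (comp (addFalseFlag n S) π₁) (comp (addFalseFlag n T) π₂)
addFalseFlag n (M S)   = pair (comp (consFalse n) π₁) (comp (mapM (addFalseFlag n S)) π₂)

mutual
  addFalseFlag-Marking : ∀ n S m a {P Q} → Q ≐ ∅ ◂ P → Marking n S m a P →
    Marking (suc n) S (eval (addFalseFlag n S) m) a Q
  addFalseFlag-Marking n one f tt Q≐ r = Records-◂ false f tt Q≐ (mk⇔ (λ ()) (λ ())) r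
  addFalseFlag-Marking n (S ⊕ T) (inj₁ m) (inj₁ a) Q≐ r = addFalseFlag-Marking n S m a Q≐ r
  addFalseFlag-Marking n (S ⊕ T) (inj₂ m) (inj₂ b) Q≐ r = addFalseFlag-Marking n T m b Q≐ r
  addFalseFlag-Marking n (S ⊗ T) (ma , mb) (a , b) Q≐ (ra , rb) =
    addFalseFlag-Marking n S ma a (◂-∘ᵖ inj₁ Q≐) ra , addFalseFlag-Marking n T mb b (◂-∘ᵖ inj₂ Q≐) rb
  addFalseFlag-Marking n (M S) (f , ms) xs Q≐ (rf , rms) =
    Records-◂ false f (inj₁ tt) Q≐ (mk⇔ (λ ()) (λ ())) rf ,
    addFalseFlag-Markings n S ms xs (◂-∘ᵖ inj₂ Q≐) rms

  addFalseFlag-Markings : ∀ n S ms xs {P Q} → Q ≐ ∅ ◂ P → Markings n S ms xs P →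
    Markings (suc n) S (map (eval (addFalseFlag n S)) ms) xs Q
  addFalseFlag-Markings n S [] [] Q≐ r = tt
  addFalseFlag-Markings n S (m ∷ ms) (x ∷ xs) Q≐ (rm , rms) =
    addFalseFlag-Marking n S m x (◂-∘ᵖ (memberHere S x xs) Q≐) rm ,
    addFalseFlag-Markings n S ms xs (◂-∘ᵖ (memberThere S x xs) Q≐) rms

appendD : ∀ {X Y} → Der X (M Y) → Der X (M Y) → Der X (M Y)
appendD l r = comp union (comp add (pair l (comp (singletonD _) r)))

-- All ways of adding a new flag 0 that is true at exactly one element.
mutual
  extensions : ∀ n S → Der (Marked n S) (M (Marked (suc n) S))
  extensions n one     = comp (singletonD _) (consTrue n)
  extensions n (S ⊕ T) = copair (comp (mapM ι₁) (extensions n S)) (comp (mapM ι₂) (extensions n T))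
  extensions n (S ⊗ T) = appendD
    (comp (mapM (pair π₂ π₁))
          (comp (strength _ _) (pair (comp (addFalseFlag n T) π₂) (comp (extensions n S) π₁))))
    (comp (strength _ _) (pair (comp (addFalseFlag n S) π₁) (comp (extensions n T) π₂)))
  extensions n (M S)   = comp add (pair (rootExtension n S)
    (comp union (comp (mapM (memberExtensions n S)) (comp (strength _ _) (pair π₁ (comp choices π₂))))))

  rootExtension : ∀ n S → Der (Marked n (M S)) (Marked (suc n) (M S))
  rootExtension n S = pair (comp (consTrue n) π₁) (comp (mapM (addFalseFlag n S)) π₂)

  -- given the root flags and a choice (x , rest) of a member, the extensions inside x
  memberExtensions : ∀ n S → Der (Flags n ⊗ (Marked n S ⊗ M (Marked n S))) (M (Marked (suc n) (M S)))
  memberExtensions n S = comp (mapM (reassemble n S))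
    (comp (strength _ _) (pair (pair π₁ (comp π₂ π₂)) (comp (extensions n S) (comp π₁ π₂))))

  reassemble : ∀ n S → Der ((Flags n ⊗ M (Marked n S)) ⊗ Marked (suc n) S) (Marked (suc n) (M S))
  reassemble n S = pair (comp (consFalse n) (comp π₁ π₁))
                        (comp add (pair π₂ (comp (mapM (addFalseFlag n S)) (comp π₂ π₁))))

module _ (n : ℕ) (S : Ty) where

  addFalseFlags : List (Val (Marked n S)) → List (Val (Marked (suc n) S))
  addFalseFlags = map (eval (addFalseFlag n S))

  withMember : Val (Marked n S ⊗ M (Marked n S)) → List (List (Val (Marked (suc n) S)))
  withMember (x , rest) = map (_∷ addFalseFlags rest) (eval (extensions n S) x)

  memberLists : List (Val (Marked n S)) → List (List (Val (Marked (suc n) S)))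
  memberLists ms = concat (map withMember (choicesL ms))

insertSecond : ∀ {A : Set} → A → List A → List A
insertSecond z []      = [ z ]
insertSecond z (y ∷ t) = y ∷ z ∷ t

eval-extensions-⊗ : ∀ n S T ma mb → eval (extensions n (S ⊗ T)) (ma , mb) ≡
  map (_, eval (addFalseFlag n T) mb) (eval (extensions n S) ma) ++
  map (eval (addFalseFlag n S) ma ,_) (eval (extensions n T) mb)
eval-extensions-⊗ n S T ma mb = cong₂ _++_
  (trans (cong (map _) (eval-strength _ _ _ (eval (extensions n S) ma))) (sym (map-∘ _)))
  (trans (++-identityʳ _) (eval-strength _ _ _ (eval (extensions n T) mb)))

eval-extensions-M : ∀ n S f ms → eval (extensions n (M S)) (f , ms) ≡
  eval (rootExtension n S) (f , ms) ∷ map ((false , f) ,_) (memberLists n S ms)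
eval-extensions-M n S f ms = cong (eval (rootExtension n S) (f , ms) ∷_) (begin
  concat (map (eval (memberExtensions n S)) (eval (strength _ _) (f , choicesL ms)))
    ≡⟨ cong (concat ∘ map _) (eval-strength _ _ f (choicesL ms)) ⟩
  concat (map (eval (memberExtensions n S)) (map (f ,_) (choicesL ms)))
    ≡⟨ cong concat (sym (map-∘ (choicesL ms))) ⟩
  concat (map (λ c → eval (memberExtensions n S) (f , c)) (choicesL ms))
    ≡⟨ cong concat (map-cong choice (choicesL ms)) ⟩
  concat (map (map ((false , f) ,_) ∘ withMember n S) (choicesL ms))
    ≡⟨ cong concat (map-∘ (choicesL ms)) ⟩
  concat (map (map ((false , f) ,_)) (map (withMember n S) (choicesL ms)))
    ≡⟨ concat-map (map (withMember n S) (choicesL ms)) ⟩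
  map ((false , f) ,_) (memberLists n S ms) ∎)
  where
  open ≡-Reasoning
  choice : ∀ c → eval (memberExtensions n S) (f , c) ≡ map ((false , f) ,_) (withMember n S c)
  choice (x , rest) = begin
    map (eval (reassemble n S)) (eval (strength _ _) ((f , rest) , eval (extensions n S) x))
      ≡⟨ cong (map _) (eval-strength _ _ (f , rest) (eval (extensions n S) x)) ⟩
    map (eval (reassemble n S)) (map ((f , rest) ,_) (eval (extensions n S) x))
      ≡⟨ map-∘ (eval (extensions n S) x) ⟨
    map (λ x′ → (false , f) , x′ ∷ addFalseFlags n S rest) (eval (extensions n S) x)
      ≡⟨ map-∘ (eval (extensions n S) x) ⟩
    map ((false , f) ,_) (withMember n S (x , rest)) ∎

memberLists-∷ : ∀ n S x ms → memberLists n S (x ∷ ms) ≡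
  withMember n S (x , ms) ++ map (insertSecond (eval (addFalseFlag n S) x)) (memberLists n S ms)
memberLists-∷ n S x ms = cong (withMember n S (x , ms) ++_) (begin
  concat (map (withMember n S) (map (λ p → proj₁ p , x ∷ proj₂ p) (choicesL ms)))
    ≡⟨ cong concat (sym (map-∘ (choicesL ms))) ⟩
  concat (map (λ p → withMember n S (proj₁ p , x ∷ proj₂ p)) (choicesL ms))
    ≡⟨ cong concat (map-cong (λ p → map-∘ (eval (extensions n S) (proj₁ p))) (choicesL ms)) ⟩
  concat (map (map (insertSecond _) ∘ withMember n S) (choicesL ms))
    ≡⟨ cong concat (map-∘ (choicesL ms)) ⟩
  concat (map (map (insertSecond _)) (map (withMember n S) (choicesL ms)))
    ≡⟨ concat-map (map (withMember n S) (choicesL ms)) ⟩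
  map (insertSecond _) (memberLists n S ms) ∎)
  where open ≡-Reasoning

point-◂-∘ᵖ : ∀ {n} {A B : Set} {P : Preds n B} (f : A → B) {e} → (∀ {x} → f e ≡ f x → e ≡ x) →
  (e ≡_) ◂ (P ∘ᵖ f) ≐ ((f e ≡_) ◂ P) ∘ᵖ f
point-◂-∘ᵖ f f-inj zero    x = mk⇔ (cong f) f-inj
point-◂-∘ᵖ f f-inj (suc i) x = ⇔-refl

point-◂-apart : ∀ {n} {A B : Set} {P : Preds n B} (g : A → B) {b} → (∀ x → b ≢ g x) →
  ((b ≡_) ◂ P) ∘ᵖ g ≐ ∅ ◂ (P ∘ᵖ g)
point-◂-apart g apart zero    x = mk⇔ (apart x) (λ ())
point-◂-apart g apart (suc i) x = ⇔-refl

insertSecond-Iso : ∀ {S} (z : Val S) l → Iso (M S) (z ∷ l) (insertSecond z l)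
insertSecond-Iso z []      = Iso-refl _ _
insertSecond-Iso z (y ∷ t) = swap≅

-- Only up to isomorphism: the enumeration of a multiset moves the member
-- containing the new flag to the front.
ExtendsAt : ∀ n S (a : Val S) → Preds n (El S a) → El S a → Val (Marked (suc n) S) → Set
ExtendsAt n S a P e m′ =
  Σ[ m₀ ∈ Val (Marked (suc n) S) ]
    (Marking (suc n) S m₀ a ((e ≡_) ◂ P) × Iso (Marked (suc n) S) m₀ m′)

ExtendsAtMember : ∀ n S (xs : List (Val S)) → Preds n (MemberEl S xs) → MemberEl S xs →
  List (Val (Marked (suc n) S)) → Set
ExtendsAtMember n S xs Q p l =
  Σ[ l₀ ∈ List (Val (Marked (suc n) S)) ]
    (Markings (suc n) S l₀ xs ((p ≡_) ◂ Q) × Iso (M (Marked (suc n) S)) l₀ l)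

module _ (n : ℕ) where

  extendsAt-one : ∀ f {P} → Records f P tt → ExtendsAt n one tt P tt (true , f)
  extendsAt-one f r = _ , Records-◂ true f tt ≐-refl (mk⇔ (λ _ → refl) (λ _ → refl)) r , Iso-refl _ _

  extendsAt-⊗₁ : ∀ S T {a b P e m′} mb → Marking n T mb b (P ∘ᵖ inj₂) →
    ExtendsAt n S a (P ∘ᵖ inj₁) e m′ → ExtendsAt n (S ⊗ T) (a , b) P (inj₁ e) (m′ , eval (addFalseFlag n T) mb)
  extendsAt-⊗₁ S T {a} {b} mb rb (m₀ , r₀ , iso) = _ ,
    (Marking-cong (suc n) S m₀ a (point-◂-∘ᵖ inj₁ inj₁-injective) r₀ ,
     addFalseFlag-Marking n T mb b (point-◂-apart inj₂ (λ _ ())) rb) ,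
    (iso ,≅ Iso-refl _ _)

  extendsAt-⊗₂ : ∀ S T {a b P e m′} ma → Marking n S ma a (P ∘ᵖ inj₁) →
    ExtendsAt n T b (P ∘ᵖ inj₂) e m′ → ExtendsAt n (S ⊗ T) (a , b) P (inj₂ e) (eval (addFalseFlag n S) ma , m′)
  extendsAt-⊗₂ S T {a} {b} ma ra (m₀ , r₀ , iso) = _ ,
    (addFalseFlag-Marking n S ma a (point-◂-apart inj₁ (λ _ ())) ra ,
     Marking-cong (suc n) T m₀ b (point-◂-∘ᵖ inj₂ inj₂-injective) r₀) ,
    (Iso-refl _ _ ,≅ iso)

  extendsAt-root : ∀ S {xs P} f ms → Marking n (M S) (f , ms) xs P →
    ExtendsAt n (M S) xs P (inj₁ tt) (eval (rootExtension n S) (f , ms))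
  extendsAt-root S {xs} f ms (rf , rms) = _ ,
    (Records-◂ true f (inj₁ tt) ≐-refl (mk⇔ (λ _ → refl) (λ _ → refl)) rf ,
     addFalseFlag-Markings n S ms xs (point-◂-apart inj₂ (λ _ ())) rms) ,
    Iso-refl _ _

  extendsAt-member : ∀ S {xs P p l} f → Records f P (inj₁ tt) →
    ExtendsAtMember n S xs (P ∘ᵖ inj₂) p l → ExtendsAt n (M S) xs P (inj₂ p) ((false , f) , l)
  extendsAt-member S {xs} f rf (l₀ , rl , iso) = _ ,
    (Records-◂ false f (inj₁ tt) ≐-refl (mk⇔ (λ ()) (λ ())) rf ,
     Markings-cong (suc n) S l₀ xs (point-◂-∘ᵖ inj₂ inj₂-injective) rl) ,
    (Iso-refl _ _ ,≅ iso)

  extendsAtMember-here : ∀ S {y xs Q e m′} ms → Markings n S ms xs (Q ∘ᵖ memberThere S y xs) →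
    ExtendsAt n S y (Q ∘ᵖ memberHere S y xs) e m′ →
    ExtendsAtMember n S (y ∷ xs) Q (memberHere S y xs e) (m′ ∷ addFalseFlags n S ms)
  extendsAtMember-here S {y} {xs} ms rms (m₀ , r₀ , iso) = _ ,
    (Marking-cong (suc n) S m₀ y (point-◂-∘ᵖ (memberHere S y xs) (λ { refl → refl })) r₀ ,
     addFalseFlag-Markings n S ms xs (point-◂-apart (memberThere S y xs) (λ _ ())) rms) ,
    (iso ∷≅ Iso-refl _ _)

  extendsAtMember-there : ∀ S {y xs Q p l} x → Marking n S x y (Q ∘ᵖ memberHere S y xs) →
    ExtendsAtMember n S xs (Q ∘ᵖ memberThere S y xs) p l →
    ExtendsAtMember n S (y ∷ xs) Q (memberThere S y xs p) (insertSecond (eval (addFalseFlag n S) x) l)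
  extendsAtMember-there S {y} {xs} {l = l} x rx (l₀ , rl , iso) = _ ,
    (addFalseFlag-Marking n S x y (point-◂-apart (memberHere S y xs) (λ _ ())) rx ,
     Markings-cong (suc n) S l₀ xs (point-◂-∘ᵖ (memberThere S y xs) (λ { refl → refl })) rl) ,
    trans≅ (Iso-refl _ _ ∷≅ iso) (insertSecond-Iso _ l)

mutual
  extensions-sound : ∀ n S m a P → Marking n S m a P →
    All (λ m′ → Σ[ e ∈ El S a ] ExtendsAt n S a P e m′) (eval (extensions n S) m)
  extensions-sound n one f tt P r = (tt , extendsAt-one n f r) ∷ []
  extensions-sound n (S ⊕ T) (inj₁ m) (inj₁ a) P r =
    All.map⁺ (All.map (λ { (e , m₀ , r₀ , iso) → e , inj₁ m₀ , r₀ , inj₁≅ iso }) (extensions-sound n S m a P r))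
  extensions-sound n (S ⊕ T) (inj₂ m) (inj₂ b) P r =
    All.map⁺ (All.map (λ { (e , m₀ , r₀ , iso) → e , inj₂ m₀ , r₀ , inj₂≅ iso }) (extensions-sound n T m b P r))
  extensions-sound n (S ⊗ T) (ma , mb) (a , b) P (ra , rb) rewrite eval-extensions-⊗ n S T ma mb =
    All.++⁺ (All.map⁺ (All.map (Product.map inj₁ (extendsAt-⊗₁ n S T mb rb))
                               (extensions-sound n S ma a _ ra)))
            (All.map⁺ (All.map (Product.map inj₂ (extendsAt-⊗₂ n S T ma ra))
                               (extensions-sound n T mb b _ rb)))
  extensions-sound n (M S) (f , ms) xs P (rf , rms) rewrite eval-extensions-M n S f ms =
    (inj₁ tt , extendsAt-root n S f ms (rf , rms)) ∷
    All.map⁺ (All.map (Product.map inj₂ (extendsAt-member n S f rf)) (memberLists-sound n S ms xs _ rms))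

  memberLists-sound : ∀ n S ms xs Q → Markings n S ms xs Q →
    All (λ l → Σ[ p ∈ MemberEl S xs ] ExtendsAtMember n S xs Q p l) (memberLists n S ms)
  memberLists-sound n S [] [] Q r = []
  memberLists-sound n S (x ∷ ms) (y ∷ xs) Q (rx , rms) rewrite memberLists-∷ n S x ms =
    All.++⁺ (All.map⁺ (All.map (Product.map (memberHere S y xs) (extendsAtMember-here n S ms rms))
                               (extensions-sound n S x y _ rx)))
            (All.map⁺ (All.map (Product.map (memberThere S y xs) (extendsAtMember-there n S x rx))
                               (memberLists-sound n S ms xs _ rms)))

mutual
  extensions-complete : ∀ n S m a P → Marking n S m a P →
    ∀ e → Any (ExtendsAt n S a P e) (eval (extensions n S) m)
  extensions-complete n one f tt P r tt = here (extendsAt-one n f r)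
  extensions-complete n (S ⊕ T) (inj₁ m) (inj₁ a) P r e =
    Any.map⁺ (Any.map (λ { (m₀ , r₀ , iso) → inj₁ m₀ , r₀ , inj₁≅ iso }) (extensions-complete n S m a P r e))
  extensions-complete n (S ⊕ T) (inj₂ m) (inj₂ b) P r e =
    Any.map⁺ (Any.map (λ { (m₀ , r₀ , iso) → inj₂ m₀ , r₀ , inj₂≅ iso }) (extensions-complete n T m b P r e))
  extensions-complete n (S ⊗ T) (ma , mb) (a , b) P (ra , rb) (inj₁ e) rewrite eval-extensions-⊗ n S T ma mb =
    Any.++⁺ˡ (Any.map⁺ (Any.map (extendsAt-⊗₁ n S T mb rb) (extensions-complete n S ma a _ ra e)))
  extensions-complete n (S ⊗ T) (ma , mb) (a , b) P (ra , rb) (inj₂ e) rewrite eval-extensions-⊗ n S T ma mb =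
    Any.++⁺ʳ _ (Any.map⁺ (Any.map (extendsAt-⊗₂ n S T ma ra) (extensions-complete n T mb b _ rb e)))
  extensions-complete n (M S) (f , ms) xs P (rf , rms) (inj₁ tt) rewrite eval-extensions-M n S f ms =
    here (extendsAt-root n S f ms (rf , rms))
  extensions-complete n (M S) (f , ms) xs P (rf , rms) (inj₂ p) rewrite eval-extensions-M n S f ms =
    there (Any.map⁺ (Any.map (extendsAt-member n S f rf) (memberLists-complete n S ms xs _ rms p)))

  memberLists-complete : ∀ n S ms xs Q → Markings n S ms xs Q →
    ∀ p → Any (ExtendsAtMember n S xs Q p) (memberLists n S ms)
  memberLists-complete n S (x ∷ ms) (y ∷ xs) Q (rx , rms) (zero , e) rewrite memberLists-∷ n S x ms =
    Any.++⁺ˡ (Any.map⁺ (Any.map (extendsAtMember-here n S ms rms) (extensions-complete n S x y _ rx e)))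
  memberLists-complete n S (x ∷ ms) (y ∷ xs) Q (rx , rms) (suc k , e) rewrite memberLists-∷ n S x ms =
    Any.++⁺ʳ _ (Any.map⁺ (Any.map (extendsAtMember-there n S x rx)
                                  (memberLists-complete n S ms xs _ rms (k , e))))

existsNew forallNew : ∀ n S → Der (Marked (suc n) S) Bool → Der (Marked n S) Bool
existsNew n S t = comp (existsD t) (extensions n S)
forallNew n S t = ¬D existsNew n S (¬D t)

DecidesAtNew : ∀ n S → Der (Marked (suc n) S) Bool → (a : Val S) → Preds n (El S a) → (El S a → Set) → Set
DecidesAtNew n S t a P Q =
  ∀ e m₀ → Marking (suc n) S m₀ a ((e ≡_) ◂ P) → (eval t m₀ ≡ true) ⇔ Q e

eval-Bool-Iso : ∀ {S} (t : Der S Bool) {a b} → Iso S a b → eval t a ≡ eval t b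
eval-Bool-Iso t iso = Iso-Bool⇒≡ (eval-Iso t iso)

existsNew-true : ∀ n S t m a P Q → Marking n S m a P → DecidesAtNew n S t a P Q →
  (eval (existsNew n S t) m ≡ true) ⇔ Σ (El S a) Q
existsNew-true n S t m a P Q r t-Q = ⇔-trans (existsD-true t (eval (extensions n S) m)) (mk⇔ to from)
  where
  to : Any (λ m′ → eval t m′ ≡ true) (eval (extensions n S) m) → Σ (El S a) Q
  to t-true with (e , m₀ , r₀ , iso) , t-true′ ← All.lookupAny (extensions-sound n S m a P r) t-true =
    e , Equivalence.to (t-Q e m₀ r₀) (trans (eval-Bool-Iso t iso) t-true′)
  from : Σ (El S a) Q → Any (λ m′ → eval t m′ ≡ true) (eval (extensions n S) m)
  from (e , q) = Any.map
    (λ { (m₀ , r₀ , iso) → trans (sym (eval-Bool-Iso t iso)) (Equivalence.from (t-Q e m₀ r₀) q) })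
    (extensions-complete n S m a P r e)

≡true? : (b : Val Bool) → Dec (b ≡ true)
≡true? (inj₁ tt) = yes refl
≡true? (inj₂ tt) = no (λ ())

-- Q is decidable because t computes it; this is what turns ¬ ∃ ¬ into ∀.
DecidesAtNew-dec : ∀ n S t m a P Q → Marking n S m a P → DecidesAtNew n S t a P Q → ∀ e → Dec (Q e)
DecidesAtNew-dec n S t m a P Q r t-Q e
  with _ , m₀ , r₀ , _ ← Any.satisfied (extensions-complete n S m a P r e) =
  Dec.map (t-Q e m₀ r₀) (≡true? (eval t m₀))

forallNew-true : ∀ n S t m a P Q → Marking n S m a P → DecidesAtNew n S t a P Q →
  (eval (forallNew n S t) m ≡ true) ⇔ (∀ e → Q e)
forallNew-true n S t m a P Q r t-Q =
  ⇔-trans (¬D-true (existsNew n S (¬D t)) m)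
    (⇔-trans (¬-cong-⇔ (existsNew-true n S (¬D t) m a P (¬_ ∘ Q) r
                          (λ e m₀ r₀ → ⇔-trans (¬D-true t m₀) (¬-cong-⇔ (t-Q e m₀ r₀)))))
      (mk⇔ (λ ¬∃¬Q e → decidable-stable (dec e) (λ ¬q → ¬∃¬Q (e , ¬q)))
           (λ ∀Q (e , ¬q) → ¬q (∀Q e))))
  where
  dec = DecidesAtNew-dec n S t m a P Q r t-Q

-- Variable i of a formula is evaluated through flag σ i.
compile : ∀ {n n′ S} → (Fin n → Fin n′) → Fm S n → Der (Marked n′ S) Bool
compile σ (rel s vs)             = holdsD s (vmap σ vs)
compile {S = S} σ (eq i j)       = flaggedBoth S (σ i) (σ j)
compile σ (neg φ)                = ¬D compile σ φ
compile σ (and φ ψ)              = compile σ φ ∧D compile σ ψ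
compile σ (or φ ψ)               = compile σ φ ∨D compile σ ψ
compile {n′ = n′} {S} σ (all φ)  = forallNew n′ S (compile (lift 1 σ) φ)
compile {n′ = n′} {S} σ (ex φ)   = existsNew n′ S (compile (lift 1 σ) φ)

Pointed : ∀ {n n′} {A : Set} → Preds n′ A → (Fin n → Fin n′) → Vec A n → Set
Pointed P σ ρ = ∀ i e → P (σ i) e ⇔ (vlookup ρ i ≡ e)

Pointed-◂ : ∀ {n n′} {A : Set} {P : Preds n′ A} {σ : Fin n → Fin n′} ρ e →
  Pointed P σ ρ → Pointed ((e ≡_) ◂ P) (lift 1 σ) (e ∷ ρ)
Pointed-◂ ρ e pt zero    e′ = ⇔-refl
Pointed-◂ ρ e pt (suc i) e′ = pt i e′

Pointwise-Pointed : ∀ {n n′ m} {A : Set} {P : Preds n′ A} {σ : Fin n → Fin n′} ρ → Pointed P σ ρ →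
  (vs : Vec (Fin n) m) (us : Vec A m) → Pointwise P (vmap σ vs) us ⇔ (vmap (vlookup ρ) vs ≡ us)
Pointwise-Pointed ρ pt [] [] = mk⇔ (λ _ → refl) (λ _ → [])
Pointwise-Pointed ρ pt (v ∷ vs) (u ∷ us) = mk⇔
  (λ { (p ∷ ps) → cong₂ _∷_ (Equivalence.to (pt v u) p) (Equivalence.to (Pointwise-Pointed ρ pt vs us) ps) })
  (λ { refl → Equivalence.from (pt v u) refl ∷ Equivalence.from (Pointwise-Pointed ρ pt vs us) refl })

compile-correct : ∀ {n n′ S} (σ : Fin n → Fin n′) (φ : Fm S n) m a P (ρ : Vec (El S a) n) →
  Pointed P σ ρ → Marking n′ S m a P → (eval (compile σ φ) m ≡ true) ⇔ Sat φ a ρ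
compile-correct σ (rel s vs) m a P ρ pt r = ⇔-trans (holdsD-computes s (vmap σ vs) m a P r) (mk⇔
  (λ { (us , fl , h) → subst (Holds s a) (sym (Equivalence.to (Pointwise-Pointed ρ pt vs us) fl)) h })
  (λ h → _ , Equivalence.from (Pointwise-Pointed ρ pt vs _) refl , h))
compile-correct {S = S} σ (eq i j) m a P ρ pt r = ⇔-trans (flaggedBoth-computes S (σ i) (σ j) m a P r) (mk⇔
  (λ { (e , p , q) → trans (Equivalence.to (pt i e) p) (sym (Equivalence.to (pt j e) q)) })
  (λ ρi≡ρj → vlookup ρ j , Equivalence.from (pt i _) ρi≡ρj , Equivalence.from (pt j _) refl))
compile-correct σ (neg φ) m a P ρ pt r =
  ⇔-trans (¬D-true (compile σ φ) m) (¬-cong-⇔ (compile-correct σ φ m a P ρ pt r))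
compile-correct σ (and φ ψ) m a P ρ pt r =
  ⇔-trans (∧D-true (compile σ φ) (compile σ ψ) m)
    (compile-correct σ φ m a P ρ pt r ×-⇔ compile-correct σ ψ m a P ρ pt r)
compile-correct σ (or φ ψ) m a P ρ pt r =
  ⇔-trans (∨D-true (compile σ φ) (compile σ ψ) m)
    (compile-correct σ φ m a P ρ pt r ⊎-⇔ compile-correct σ ψ m a P ρ pt r)
compile-correct {n′ = n′} {S} σ (all φ) m a P ρ pt r =
  forallNew-true n′ S (compile (lift 1 σ) φ) m a P _ r
    (λ e m₀ r₀ → compile-correct (lift 1 σ) φ m₀ a _ (e ∷ ρ) (Pointed-◂ ρ e pt) r₀)
compile-correct {n′ = n′} {S} σ (ex φ) m a P ρ pt r =
  existsNew-true n′ S (compile (lift 1 σ) φ) m a P _ r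
    (λ e m₀ r₀ → compile-correct (lift 1 σ) φ m₀ a _ (e ∷ ρ) (Pointed-◂ ρ e pt) r₀)

orFlags : ∀ n → Der (Flags n ⊗ Flags n) (Flags n)
orFlags zero    = terminal _
orFlags (suc n) = pair (comp π₁ π₁ ∨D comp π₁ π₂) (comp (orFlags n) (pair (comp π₂ π₁) (comp π₂ π₂)))

flag-orFlags : ∀ n f g (i : Fin n) →
  (flag (eval (orFlags n) (f , g)) i ≡ true) ⇔ (flag f i ≡ true ⊎ flag g i ≡ true)
flag-orFlags (suc n) (b , f) (c , g) zero    = ∨D-true (comp π₁ π₁) (comp π₁ π₂) ((b , f) , (c , g))
flag-orFlags (suc n) (b , f) (c , g) (suc i) = flag-orFlags n f g i

-- The distinguished point of a V₁ T-structure becomes the new flag 0.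
pointToFlag : ∀ j T → Der (Marked j (V1 T)) (Marked (suc j) T)
pointToFlag j one     = consTrue j
pointToFlag j (S ⊕ T) = copair (comp ι₁ (pointToFlag j S)) (comp ι₂ (pointToFlag j T))
pointToFlag j (S ⊗ T) = copair (pair (comp (pointToFlag j S) π₁) (comp (addFalseFlag j T) π₂))
                               (pair (comp (addFalseFlag j S) π₁) (comp (pointToFlag j T) π₂))
pointToFlag j (M S)   = comp (copair atRoot atMember) (comp dist (pair π₂ π₁))
  where
  -- the extra element of the 1 summand and the root both decode to the root
  atRoot : Der ((Flags j ⊗ M (Marked j S)) ⊗ Flags j) (Marked (suc j) (M S))
  atRoot = pair (pair (trueD _) (comp (orFlags j) (pair π₂ (comp π₁ π₁))))
                (comp (mapM (addFalseFlag j S)) (comp π₂ π₁))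
  atMember : Der ((Flags j ⊗ M (Marked j S)) ⊗ Marked j (V1 S)) (Marked (suc j) (M S))
  atMember = pair (comp (consFalse j) (comp π₁ π₁))
                  (comp add (pair (comp (pointToFlag j S) π₂) (comp (mapM (addFalseFlag j S)) (comp π₂ π₁))))

push : ∀ {n} {A B : Set} → (A → B) → Preds n A → Preds n B
push {A = A} f P i b = Σ[ a ∈ A ] (f a ≡ b × P i a)

push-id : ∀ {n} {A : Set} {P : Preds n A} → push id P ≐ P
push-id i a = mk⇔ (λ { (_ , refl , p) → p }) (λ p → a , refl , p)

push-along : ∀ {n} {A A₁ B B₁ : Set} {P : Preds n A} (tr : A → B) (ι : A₁ → A) (tr₁ : A₁ → B₁) (h : B₁ → B) →
  (∀ {b b′} → h b ≡ h b′ → b ≡ b′) → (∀ a₁ → tr (ι a₁) ≡ h (tr₁ a₁)) →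
  (∀ a b → tr a ≡ h b → Σ[ a₁ ∈ A₁ ] ι a₁ ≡ a) →
  push tr P ∘ᵖ h ≐ push tr₁ (P ∘ᵖ ι)
push-along {P = P} tr ι tr₁ h h-inj tr∘ι onto i b = mk⇔ to from
  where
  to : push tr P i (h b) → push tr₁ (P ∘ᵖ ι) i b
  to (a , tr-a , p) with a₁ , refl ← onto a b tr-a = a₁ , h-inj (trans (sym (tr∘ι a₁)) tr-a) , p
  from : push tr₁ (P ∘ᵖ ι) i b → push tr P i (h b)
  from (a₁ , refl , p) = ι a₁ , tr∘ι a₁ , p

≐-trans : ∀ {n} {A : Set} {P Q R : Preds n A} → P ≐ Q → Q ≐ R → P ≐ R
≐-trans P≐Q Q≐R i a = ⇔-trans (P≐Q i a) (Q≐R i a)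

◂-cong : ∀ {n} {A : Set} {Q : Preds (suc n) A} {Q₀ Q₀′ : A → Set} {P P′ : Preds n A} →
  Q ≐ Q₀ ◂ P → (∀ a → Q₀ a ⇔ Q₀′ a) → P ≐ P′ → Q ≐ Q₀′ ◂ P′
◂-cong Q≐ Q₀⇔ P≐ zero    a = ⇔-trans (Q≐ zero a) (Q₀⇔ a)
◂-cong Q≐ Q₀⇔ P≐ (suc i) a = ⇔-trans (Q≐ (suc i) a) (P≐ i a)

decodedFlags : ∀ {j} T (y : Val (V1 T)) → Preds j (El (V1 T) y) → Preds (suc j) (El T (proj₁ (dec1 T y)))
decodedFlags T y P = (proj₂ (dec1 T y) ≡_) ◂ push (tr1 T y) P

pointToFlag-Marking : ∀ j T m y P {Q} → Q ≐ decodedFlags T y P → Marking j (V1 T) m y P →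
  Marking (suc j) T (eval (pointToFlag j T) m) (proj₁ (dec1 T y)) Q
pointToFlag-Marking j one f tt P Q≐ r =
  Records-◂ true f tt (◂-cong Q≐ (λ _ → ⇔-refl) push-id) (mk⇔ (λ _ → refl) (λ _ → refl)) r
pointToFlag-Marking j (S ⊕ T) (inj₁ m) (inj₁ p) P Q≐ r = pointToFlag-Marking j S m p P Q≐ r
pointToFlag-Marking j (S ⊕ T) (inj₂ m) (inj₂ q) P Q≐ r = pointToFlag-Marking j T m q P Q≐ r
pointToFlag-Marking j (S ⊗ T) (inj₁ (mp , mb)) (inj₁ (p , b)) P Q≐ (rp , rb) =
  pointToFlag-Marking j S mp p (P ∘ᵖ inj₁)
    (◂-cong (◂-∘ᵖ inj₁ Q≐) (λ _ → mk⇔ inj₁-injective (cong inj₁))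
      (push-along (tr1 (S ⊗ T) (inj₁ (p , b))) inj₁ (tr1 S p) inj₁ inj₁-injective (λ _ → refl)
        λ { (inj₁ a) _ _ → a , refl ; (inj₂ _) _ () })) rp ,
  addFalseFlag-Marking j T mb b
    (◂-cong (◂-∘ᵖ inj₂ Q≐) (λ _ → mk⇔ (λ ()) (λ ()))
      (≐-trans (push-along (tr1 (S ⊗ T) (inj₁ (p , b))) inj₂ id inj₂ inj₂-injective (λ _ → refl)
                 λ { (inj₁ _) _ () ; (inj₂ a) _ _ → a , refl })
               push-id)) rb
pointToFlag-Marking j (S ⊗ T) (inj₂ (ma , mq)) (inj₂ (a , q)) P Q≐ (ra , rq) =
  addFalseFlag-Marking j S ma a
    (◂-cong (◂-∘ᵖ inj₁ Q≐) (λ _ → mk⇔ (λ ()) (λ ()))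
      (≐-trans (push-along (tr1 (S ⊗ T) (inj₂ (a , q))) inj₁ id inj₁ inj₁-injective (λ _ → refl)
                 λ { (inj₁ e) _ _ → e , refl ; (inj₂ _) _ () })
               push-id)) ra ,
  pointToFlag-Marking j T mq q (P ∘ᵖ inj₂)
    (◂-cong (◂-∘ᵖ inj₂ Q≐) (λ _ → mk⇔ inj₂-injective (cong inj₂))
      (push-along (tr1 (S ⊗ T) (inj₂ (a , q))) inj₂ (tr1 T q) inj₂ inj₂-injective (λ _ → refl)
        λ { (inj₁ _) _ () ; (inj₂ e) _ _ → e , refl })) rq
pointToFlag-Marking j (M S) (inj₁ f₀ , (f , ms)) (inj₁ tt , xs) P Q≐ (r₀ , rf , rms) =
  Records-◂ true (eval (orFlags j) (f₀ , f)) (inj₁ tt) Q≐ (mk⇔ (λ _ → refl) (λ _ → refl))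
    (λ i → ⇔-trans (flag-orFlags j f₀ f i) (⇔-trans (r₀ i ⊎-⇔ rf i) (mk⇔
      [ (λ p → inj₁ tt , refl , p) , (λ p → inj₂ (inj₁ tt) , refl , p) ]′
      (λ { (inj₁ tt , _ , p) → inj₁ p ; (inj₂ (inj₁ tt) , _ , p) → inj₂ p ; (inj₂ (inj₂ _) , () , _) })))) ,
  addFalseFlag-Markings j S ms xs
    (◂-cong (◂-∘ᵖ inj₂ Q≐) (λ _ → mk⇔ (λ ()) (λ ()))
      (≐-trans (push-along (tr1 (M S) (inj₁ tt , xs)) (inj₂ ∘ inj₂) id inj₂ inj₂-injective (λ _ → refl)
                 λ { (inj₁ tt) _ () ; (inj₂ (inj₁ tt)) _ () ; (inj₂ (inj₂ e)) _ _ → e , refl })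
               push-id)) rms
pointToFlag-Marking j (M S) (inj₂ mq , (f , ms)) (inj₂ q , xs) P Q≐ (rq , rf , rms) =
  Records-◂ false f (inj₁ tt) Q≐ (mk⇔ (λ ()) (λ ()))
    (λ i → ⇔-trans (rf i) (mk⇔ (λ p → inj₂ (inj₁ tt) , refl , p)
      (λ { (inj₂ (inj₁ tt) , _ , p) → p ; (inj₁ _ , () , _) ; (inj₂ (inj₂ _) , () , _) }))) ,
  pointToFlag-Marking j S mq q (P ∘ᵖ inj₁)
    (◂-cong (◂-∘ᵖ (inj₂ ∘ memberHere S _ xs) Q≐) (λ _ → mk⇔ (λ { refl → refl }) (λ { refl → refl }))
      (push-along (tr1 (M S) (inj₂ q , xs)) inj₁ (tr1 S q) (inj₂ ∘ memberHere S _ xs)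
        (λ { refl → refl }) (λ _ → refl)
        λ { (inj₁ e) _ _ → e , refl ; (inj₂ (inj₁ tt)) _ () ; (inj₂ (inj₂ _)) _ () })) rq ,
  addFalseFlag-Markings j S ms xs
    (◂-cong (◂-∘ᵖ (inj₂ ∘ memberThere S _ xs) Q≐) (λ _ → mk⇔ (λ ()) (λ ()))
      (≐-trans (push-along (tr1 (M S) (inj₂ q , xs)) (inj₂ ∘ inj₂) id (inj₂ ∘ memberThere S _ xs)
                 (λ { refl → refl }) (λ _ → refl)
                 λ { (inj₁ _) _ () ; (inj₂ (inj₁ tt)) _ () ; (inj₂ (inj₂ e)) _ _ → e , refl })
               push-id)) rms

-- Tail-recursive addition, matching the order in which pointsToFlags
-- consumes the points.
_+′_ : ℕ → ℕ → ℕ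
zero  +′ j = j
suc k +′ j = k +′ suc j

pointsToFlags : ∀ k S j → Der (Marked j (V k S)) (Marked (k +′ j) S)
pointsToFlags zero    S j = idD
pointsToFlags (suc k) S j = comp (pointsToFlags k S (suc j)) (pointToFlag j (V k S))

decodedFlagsK : ∀ k S j (x : Val (V k S)) → Preds j (El (V k S) x) → Preds (k +′ j) (El S (proj₁ (decK k S x)))
decodedFlagsK zero    S j x P = P
decodedFlagsK (suc k) S j x P = decodedFlagsK k S (suc j) (proj₁ (dec1 (V k S) x)) (decodedFlags (V k S) x P)

pointsToFlags-Marking : ∀ k S j m x P → Marking j (V k S) m x P →
  Marking (k +′ j) S (eval (pointsToFlags k S j) m) (proj₁ (decK k S x)) (decodedFlagsK k S j x P)
pointsToFlags-Marking zero    S j m x P r = r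
pointsToFlags-Marking (suc k) S j m x P r =
  pointsToFlags-Marking k S (suc j) _ _ _ (pointToFlag-Marking j (V k S) m x P ≐-refl r)

shift : ∀ k j → Fin j → Fin (k +′ j)
shift zero    j i = i
shift (suc k) j i = shift k (suc j) (suc i)

push-∘ : ∀ {n} {A B C : Set} (g : B → C) (f : A → B) {P : Preds n A} → push g (push f P) ≐ push (g ∘ f) P
push-∘ g f i c = mk⇔ (λ { (_ , refl , a , refl , p) → a , refl , p })
                     (λ { (a , refl , p) → f a , refl , a , refl , p })

decodedFlagsK-shift : ∀ k S j x P → decodedFlagsK k S j x P ∘ shift k j ≐ push (trK k S x) P
decodedFlagsK-shift zero    S j x P i e = ⇔-sym (push-id {P = P} i e)
decodedFlagsK-shift (suc k) S j x P i =
  ≐-trans (decodedFlagsK-shift k S (suc j) (proj₁ (dec1 (V k S) x)) _ ∘ suc)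
          (push-∘ (trK k S (proj₁ (dec1 (V k S) x))) (tr1 (V k S) x)) i

data InitOrLast : ∀ {k} → Fin (suc k) → Set where
  init : ∀ {k} (i : Fin k) → InitOrLast (inject₁ i)
  last : ∀ {k} → InitOrLast (fromℕ k)

initOrLast : ∀ {k} (i : Fin (suc k)) → InitOrLast i
initOrLast {zero}  zero    = last
initOrLast {suc k} zero    = init zero
initOrLast {suc k} (suc i) with initOrLast i
... | init i′ = init (suc i′)
... | last    = last

lookup-∷ʳ-inject₁ : ∀ {k} {A : Set} (xs : Vec A k) x i → vlookup (xs ∷ʳ x) (inject₁ i) ≡ vlookup xs i
lookup-∷ʳ-inject₁ (y ∷ xs) x zero    = refl
lookup-∷ʳ-inject₁ (y ∷ xs) x (suc i) = lookup-∷ʳ-inject₁ xs x i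

lookup-∷ʳ-fromℕ : ∀ {k} {A : Set} (xs : Vec A k) x → vlookup (xs ∷ʳ x) (fromℕ k) ≡ x
lookup-∷ʳ-fromℕ []       x = refl
lookup-∷ʳ-fromℕ (y ∷ xs) x = lookup-∷ʳ-fromℕ xs x

-- The flag that pointsToFlags gives to the i-th point of decK.
pointFlag : ∀ k j → Fin k → Fin (k +′ j)
pointFlag (suc k) j i with initOrLast i
... | init i′ = pointFlag k (suc j) i′
... | last    = shift k (suc j) zero

Pointed-∷ʳ : ∀ {k j} {A : Set} (Q : Preds (suc k +′ j) A) (ρ : Vec A k) t →
  Pointed Q (pointFlag k (suc j)) ρ → (∀ e → Q (shift k (suc j) zero) e ⇔ (t ≡ e)) →
  Pointed Q (pointFlag (suc k) j) (ρ ∷ʳ t)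
Pointed-∷ʳ Q ρ t pt pt-last i e with initOrLast i
... | init i′ rewrite lookup-∷ʳ-inject₁ ρ t i′ = pt i′ e
... | last    rewrite lookup-∷ʳ-fromℕ ρ t     = pt-last e

decodedFlagsK-pointFlag : ∀ k S j x P → Pointed (decodedFlagsK k S j x P) (pointFlag k j) (proj₂ (decK k S x))
decodedFlagsK-pointFlag (suc k) S j x P =
  Pointed-∷ʳ (decodedFlagsK k S (suc j) y Py) (proj₂ (decK k S y)) (trK k S y point)
    (decodedFlagsK-pointFlag k S (suc j) y Py)
    (λ e → ⇔-trans (decodedFlagsK-shift k S (suc j) y Py zero e)
                   (mk⇔ (λ { (_ , tr≡e , refl) → tr≡e }) (λ tr≡e → point , tr≡e , refl)))
  where
  y = proj₁ (dec1 (V k S) x)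
  point = proj₂ (dec1 (V k S) x)
  Py = decodedFlags (V k S) x P

unmarked : ∀ T → Der T (Marked 0 T)
unmarked one     = idD
unmarked (S ⊕ T) = copair (comp ι₁ (unmarked S)) (comp ι₂ (unmarked T))
unmarked (S ⊗ T) = pair (comp (unmarked S) π₁) (comp (unmarked T) π₂)
unmarked (M S)   = pair (terminal _) (mapM (unmarked S))

mutual
  unmarked-Marking : ∀ T x P → Marking 0 T (eval (unmarked T) x) x P
  unmarked-Marking one     tt       P = λ ()
  unmarked-Marking (S ⊕ T) (inj₁ a) P = unmarked-Marking S a P
  unmarked-Marking (S ⊕ T) (inj₂ b) P = unmarked-Marking T b P
  unmarked-Marking (S ⊗ T) (a , b)  P = unmarked-Marking S a _ , unmarked-Marking T b _
  unmarked-Marking (M S)   xs       P = (λ ()) , unmarked-Markings S xs _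

  unmarked-Markings : ∀ S xs Q → Markings 0 S (map (eval (unmarked S)) xs) xs Q
  unmarked-Markings S []       Q = tt
  unmarked-Markings S (x ∷ xs) Q = unmarked-Marking S x _ , unmarked-Markings S xs _

lemma4p12 : (S : Ty) (k : ℕ) (φ : Fm S k) →
    Σ[ t ∈ Der (V k S) Bool ]
      ((x : Val (V k S)) →
        ((eval t x ≡ true) ⇔ Sat φ (proj₁ (decK k S x)) (proj₂ (decK k S x))))
lemma4p12 S k φ = t , correct
  where
  t : Der (V k S) Bool
  t = comp (compile (pointFlag k 0) φ) (comp (pointsToFlags k S 0) (unmarked (V k S)))
  noFlags : ∀ {A : Set} → Preds 0 A
  noFlags ()
  correct : ∀ x → (eval t x ≡ true) ⇔ Sat φ (proj₁ (decK k S x)) (proj₂ (decK k S x))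
  correct x = compile-correct (pointFlag k 0) φ _ _ (decodedFlagsK k S 0 x noFlags) (proj₂ (decK k S x))
    (decodedFlagsK-pointFlag k S 0 x noFlags)
    (pointsToFlags-Marking k S 0 _ x noFlags (unmarked-Marking (V k S) x noFlags))
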